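{- Let $p$ be a prime, $i\ge1$ and $j\ge0$ integers, and $\mathbb{U}=\mathbb{U}_i(\mathbb{Z}/p^{j+1})$. Let $1\le i'\le i$ and $j'\ge0$ be integers. Then: (a) $(\mathbb{U}^{(i')})^{p^{j'}}=\{I\}$ if and only if $j'\ge j+1+\lfloor\log_p(i/i')\rfloor$; (b) $(\mathbb{U}^{(i')})^{p^{j'}}=I+p^j\mathbb{Z}E_{1,i+1}$ if and only if $j'=j+\log_p(i/i')$ (in particular $i/i'$ is a power of $p$); (c) $(\mathbb{U}^{(i')})^{p^{j'}}\le I+p^j\mathbb{Z}E_{1,i+1}$ if and only if $j'\ge j+\log_p(i/i')$.
   Context: $\mathbb{U}_i(R)$ is the group of unipotent upper-triangular $(i+1)\times(i+1)$ matrices over a ring $R$; $I$ is the identity matrix and $E_{1,i+1}$ the matrix with $1$ at entry $(1,i+1)$ and $0$ elsewhere. For a group $G$, $G^{(1)}=G$, $G^{(k+1)}=[G,G^{(k)}]$ is the lower central series, and for a subgroup $K$, $K^m$ is the subgroup generated by all $m$-th powers of elements of $K$. -}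

module Defs where

open import Data.Nat using (ℕ; zero; suc; _+_; _*_; _^_; _≤_; _<_; _%_; NonZero)
open import Data.Fin using (Fin; zero; suc; fromℕ; _<_; _≟_)
open import Data.Product using (Σ; ∃; _×_; _,_)
open import Relation.Nullary using (yes; no)
open import Relation.Binary.PropositionalEquality using (_≡_)
open import Function.Bundles using (_⇔_)

-- The ring ℤ/N, represented as ℕ modulo the congruence a ≡ b (mod N).
-- (Every residue class of ℤ/N has a representative in ℕ.)

_≡[mod_]_ : ℕ → (N : ℕ) → .{{NonZero N}} → ℕ → Set
a ≡[mod N ] b = a % N ≡ b % N

-- Square matrices of size n over ℤ/N (entries as natural-number
-- representatives).

Mat : ℕ → Set
Mat n = Fin n → Fin n → ℕ

Σᶠ : (n : ℕ) → (Fin n → ℕ) → ℕ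
Σᶠ zero    f = 0
Σᶠ (suc n) f = f zero + Σᶠ n (λ k → f (suc k))

_·_ : {n : ℕ} → Mat n → Mat n → Mat n
_·_ {n} A B r c = Σᶠ n (λ k → A r k * B k c)

δ : {n : ℕ} → Fin n → Fin n → ℕ
δ r c with r ≟ c
... | yes _ = 1
... | no  _ = 0

𝐈 : {n : ℕ} → Mat n
𝐈 = δ

_^ᴹ_ : {n : ℕ} → Mat n → ℕ → Mat n
A ^ᴹ zero  = 𝐈
A ^ᴹ suc m = A · (A ^ᴹ m)

MatEq : (N : ℕ) → .{{NonZero N}} → {n : ℕ} → Mat n → Mat n → Set
MatEq N A B = ∀ r c → A r c ≡[mod N ] B r c

Pred : ℕ → Set₁
Pred n = Mat n → Set

module _ (N : ℕ) .{{_ : NonZero N}} (n : ℕ) where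

  private
    _≈_ : Mat n → Mat n → Set
    _≈_ = MatEq N

  Unipotent : Pred n
  Unipotent A = (∀ r c → c Data.Fin.< r → A r c ≡[mod N ] 0)
              × (∀ r → A r r ≡[mod N ] 1)

  -- subgroup generated by a set S (inside the group of invertible
  -- matrices over ℤ/N); the inverse of x is any y with x·y = I.
  data Gen (S : Pred n) : Pred n where
    gen  : ∀ {x} → S x → Gen S x
    one  : Gen S 𝐈
    mul  : ∀ {x y} → Gen S x → Gen S y → Gen S (x · y)
    inv  : ∀ {x y} → Gen S x → (x · y) ≈ 𝐈 → Gen S y
    resp : ∀ {x y} → x ≈ y → Gen S x → Gen S y

  Comm : Pred n → Pred n → Pred n
  Comm A B c = Σ (Mat n) λ g → Σ (Mat n) λ h → Σ (Mat n) λ g' → Σ (Mat n) λ h' →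
      A g × B h × (g · g') ≈ 𝐈 × (h · h') ≈ 𝐈 × c ≈ (((g' · h') · g) · h)

  CommSub : Pred n → Pred n → Pred n
  CommSub A B = Gen (Comm A B)

  -- lower central series of 𝕌:  LCS 1 = 𝕌, LCS (k+1) = [𝕌, LCS k].
  -- (LCS 0 is set to 𝕌 as well; it is never used.)
  LCS : ℕ → Pred n
  LCS zero          = Unipotent
  LCS (suc zero)    = Unipotent
  LCS (suc (suc k)) = CommSub Unipotent (LCS (suc k))

  PowSub : Pred n → ℕ → Pred n
  PowSub K m = Gen (λ x → ∃ λ y → K y × x ≈ (y ^ᴹ m))

  Trivial : Pred n
  Trivial x = x ≈ 𝐈

  _≐_ : Pred n → Pred n → Set
  A ≐ B = ∀ x → (A x ⇔ B x)

  _⊆_ : Pred n → Pred n → Set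
  A ⊆ B = ∀ x → A x → B x

-- I + q ℤ E_{1,m}  in  Mat m  (m = i+1, corner entry (1, i+1)),
-- i.e. matrices equal to I except the corner entry, which is a multiple of q.
CornerSub : (N : ℕ) .{{_ : NonZero N}} (i q : ℕ) → Pred (suc i)
CornerSub N i q x = ∃ λ t → MatEq N x (λ r c → corner r c t)
  where
  corner : Fin (suc i) → Fin (suc i) → ℕ → ℕ
  corner zero c t with c ≟ fromℕ i
  ... | yes _ = δ {suc i} zero c + t * q
  ... | no  _ = δ {suc i} zero c
  corner (suc r) c t = δ (suc r) c

-- logarithm conditions (no reals available):
-- e = ⌊log_p (i/i')⌋  ⟺  p^e · i' ≤ i < p^(e+1) · i'
IsFloorLog : ℕ → ℕ → ℕ → ℕ → Set
IsFloorLog p i i' e = (p ^ e) * i' ≤ i × i Data.Nat.< (p ^ suc e) * i'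

open import Data.Nat.Primality using (Prime; prime⇒nonZero)
open import Data.Nat.Properties using (m^n≢0)

module Setting (p : ℕ) (pp : Prime p) (i j : ℕ) where
  private
    instance
      nzp : NonZero p
      nzp = prime⇒nonZero pp
      nzN : NonZero (p ^ suc j)
      nzN = m^n≢0 p (suc j)

  N : ℕ
  N = p ^ suc j

  𝕌⁽_⁾ : ℕ → Pred (suc i)
  𝕌⁽ k ⁾ = LCS N (suc i) k

  PowLCS : ℕ → ℕ → Pred (suc i)
  PowLCS k j' = PowSub N (suc i) 𝕌⁽ k ⁾ (p ^ j')

  TrivialSub : Pred (suc i)
  TrivialSub = Trivial N (suc i)

  CornerSubgroup : Pred (suc i)
  CornerSubgroup = CornerSub N i (p ^ j)

  _≐ₛ_ : Pred (suc i) → Pred (suc i) → Set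
  A ≐ₛ B = _≐_ N (suc i) A B

  _⊆ₛ_ : Pred (suc i) → Pred (suc i) → Set
  A ⊆ₛ B = _⊆_ N (suc i) A B

-- Write n = i+1, N = p^{j+1}, K = i' and m = p^{j'}.  The proof has two halves.
--
-- Every element of 𝕌^(K) agrees with the identity on the band
-- c < r + K ("K-banded"), because commutators of a 1-banded and a k-banded
-- unipotent matrix are (k+1)-banded.  Writing such a y as I + X, the binomial
-- theorem gives y^m = I + Σ_{l≥1} C(m,l) X^l with X^l supported on c ≥ r + lK.
-- As p^{j'+1-T} divides C(p^{j'}, l) for 1 ≤ l < p^T, the entry (r,c) of y^m is
-- congruent to δ_rc modulo p^{j'+1-T} whenever c < r + p^T K.  Both {I} and the
-- corner subgroup I + p^j ℤ E_{1,i+1} are subgroups, so these congruences for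
-- the generators y^m pass to the subgroup (𝕌^(K))^m they generate.
--
-- The product P of elementary matrices I + E_{a,a+K} (a < t) lies
-- in 𝕌^(K), and the entry (0, lK) of P^m (rows and columns indexed from 0) is
-- exactly C(m,l).  For l = p^b this is p^{j'-b} times a unit, which is nonzero
-- mod N as soon as j' - b ≤ j.

module Submission where

open import Data.Nat hiding (_≟_)
open import Data.Nat.Properties hiding (_≟_)
open import Data.Nat.Properties as ℕ using ()
open import Data.Nat.Divisibility
open import Data.Nat.DivMod
open import Data.Nat.Primality
open import Data.Nat.Coprimality using (Coprime; coprime-Bézout; prime⇒coprime)
open import Data.Nat.GCD using (module Bézout)
open import Data.Nat.Solver using (module +-*-Solver)
open import Algebra.Properties.CommutativeSemigroup *-commutativeSemigroup using (x∙yz≈y∙xz)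
open import Data.Fin using (Fin; zero; suc; toℕ; fromℕ; fromℕ<; _≟_)
open import Data.Fin.Properties as FP using (toℕ-injective; toℕ<n; toℕ-fromℕ; toℕ-fromℕ<)
open import Data.Product
open import Data.Sum using (inj₁; inj₂)
open import Data.Empty
open import Relation.Nullary
open import Relation.Binary.Definitions using (tri<; tri≈; tri>)
open import Relation.Binary.PropositionalEquality hiding (resp)
open import Function.Bundles using (_⇔_; mk⇔; Equivalence)
open import Defs

-- Binomial coefficients by Pascal's recursion; unlike the library's n C k
-- (defined through factorials) this computes definitionally on successors,
-- which the matrix binomial theorem below relies on.
choose : ℕ → ℕ → ℕ
choose _       zero    = 1
choose zero    (suc k) = 0
choose (suc n) (suc k) = choose n k + choose n (suc k)

choose-big : ∀ n k → n < k → choose n k ≡ 0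
choose-big zero    (suc k) _         = refl
choose-big (suc n) (suc k) (s≤s n<k)
  rewrite choose-big n k n<k | choose-big n (suc k) (m<n⇒m<1+n n<k) = refl

choose-1 : ∀ n → choose n 1 ≡ n
choose-1 zero    = refl
choose-1 (suc n) = cong suc (choose-1 n)

-- Absorption identity (k+1)·C(n+1,k+1) = (n+1)·C(n,k); it is the source of all
-- p-divisibility of binomial coefficients used below.
absorption : ∀ n k → suc k * choose (suc n) (suc k) ≡ suc n * choose n k
absorption zero    zero    = refl
absorption zero    (suc k) = *-zeroʳ (suc (suc k))
absorption (suc n) zero    rewrite choose-1 n | *-identityʳ n | +-identityʳ n = refl
absorption (suc n) (suc k) = begin
    suc (suc k) * (X + Y)
  ≡⟨ *-distribˡ-+ (suc (suc k)) X Y ⟩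
    suc (suc k) * X + suc (suc k) * Y
  ≡⟨ cong ((X + suc k * X) +_) (absorption n (suc k)) ⟩
    (X + suc k * X) + suc n * b
  ≡⟨ cong (λ z → (X + z) + suc n * b) (absorption n k) ⟩
    (X + suc n * a) + suc n * b
  ≡⟨ +-assoc X (suc n * a) (suc n * b) ⟩
    X + (suc n * a + suc n * b)
  ≡⟨ cong (X +_) (sym (*-distribˡ-+ (suc n) a b)) ⟩
    X + suc n * X
  ∎
  where
  open ≡-Reasoning
  a = choose n k
  b = choose n (suc k)
  X = choose (suc n) (suc k)
  Y = choose (suc n) (suc (suc k))

absorption⁺ : ∀ m l → 1 ≤ m → 1 ≤ l → l * choose m l ≡ m * choose (m ∸ 1) (l ∸ 1)
absorption⁺ (suc m) (suc l) _ _ = absorption m l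

module PrimeFacts (p : ℕ) (pp : Prime p) where
  instance
    p≢0 : NonZero p
    p≢0 = prime⇒nonZero pp

  1<p : 1 < p
  1<p = nonTrivial⇒n>1 p {{prime⇒nonTrivial pp}}

  p∤1 : ¬ (p ∣ 1)
  p∤1 d = <⇒≢ 1<p (sym (∣1⇒≡1 d))

  ^-monoʳ-∣ : ∀ {a b} → a ≤ b → p ^ a ∣ p ^ b
  ^-monoʳ-∣ {a} {b} a≤b = divides (p ^ (b ∸ a)) (begin
      p ^ b               ≡⟨ cong (p ^_) (sym (m+[n∸m]≡n a≤b)) ⟩
      p ^ (a + (b ∸ a))   ≡⟨ ^-distribˡ-+-* p a (b ∸ a) ⟩
      p ^ a * p ^ (b ∸ a) ≡⟨ *-comm (p ^ a) _ ⟩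
      p ^ (b ∸ a) * p ^ a ∎)
    where open ≡-Reasoning

  cancel-unit : ∀ k l x → ¬ (p ∣ l) → p ^ k ∣ l * x → p ^ k ∣ x
  cancel-unit zero    l x _   _ = 1∣ x
  cancel-unit (suc k) l x p∤l d with euclidsLemma l x pp (∣-trans (m∣m*n (p ^ k)) d)
  ... | inj₁ p∣l = ⊥-elim (p∤l p∣l)
  ... | inj₂ (divides q refl) =
    subst (p * p ^ k ∣_) (*-comm p q) (*-monoʳ-∣ p (cancel-unit k l q p∤l (*-cancelˡ-∣ p d')))
    where
    d' : p * p ^ k ∣ p * (l * q)
    d' = subst (p * p ^ k ∣_) (trans (cong (l *_) (*-comm q p)) (x∙yz≈y∙xz l p q)) d

  cancel-small : ∀ t k l x → ¬ (p ^ suc t ∣ l) → p ^ k ∣ l * x → p ^ (k ∸ t) ∣ x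
  cancel-small zero k l x nd d =
    cancel-unit k l x (λ p∣l → nd (subst (_∣ l) (sym (*-identityʳ p)) p∣l)) d
  cancel-small (suc t) k l x nd d with p ∣? l
  cancel-small (suc t) zero    l x nd d | yes _ = 1∣ x
  cancel-small (suc t) (suc k) l x nd d | yes (divides l' refl) =
    cancel-small t k l' x nd' (*-cancelˡ-∣ p d')
    where
    nd' : ¬ (p ^ suc t ∣ l')
    nd' e = nd (subst (_∣ l' * p) (*-comm (p ^ suc t) p) (*-monoˡ-∣ p e))
    d' : p * p ^ k ∣ p * (l' * x)
    d' = subst (p * p ^ k ∣_) (trans (cong (_* x) (*-comm l' p)) (*-assoc p l' x)) d
  ... | no p∤l = ∣-trans (^-monoʳ-∣ (m∸n≤m k (suc t))) (cancel-unit k l x p∤l d)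

  choose-pow-∣ : ∀ a T l → 1 ≤ l → l < p ^ T → p ^ (suc a ∸ T) ∣ choose (p ^ a) l
  choose-pow-∣ a zero    l 1≤l l<1 = ⊥-elim (<⇒≱ l<1 1≤l)
  choose-pow-∣ a (suc t) l 1≤l l<pT = cancel-small t a l (choose (p ^ a) l) nd d
    where
    instance _ = >-nonZero 1≤l
    nd : ¬ (p ^ suc t ∣ l)
    nd e = <⇒≱ l<pT (∣⇒≤ e)
    d : p ^ a ∣ l * choose (p ^ a) l
    d = subst (p ^ a ∣_) (sym (absorption⁺ (p ^ a) l (m^n>0 p a) 1≤l)) (m∣m*n _)

  p∣choose : ∀ a l → 1 ≤ l → l < p ^ a → p ∣ choose (p ^ a) l
  p∣choose a l 1≤l l<pa =
    subst (_∣ choose (p ^ a) l) (trans (cong (p ^_) (m+n∸n≡m 1 a)) (*-identityʳ p))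
          (choose-pow-∣ a a l 1≤l l<pa)

  p^a≡suc : ∀ a → p ^ a ≡ suc (p ^ a ∸ 1)
  p^a≡suc a = sym (trans (+-comm 1 (p ^ a ∸ 1)) (m∸n+n≡m (m^n>0 p a)))

  p∤choose-pred : ∀ a k → k ≤ p ^ a ∸ 1 → ¬ (p ∣ choose (p ^ a ∸ 1) k)
  p∤choose-pred a zero    _     = p∤1
  p∤choose-pred a (suc k) sk≤M d = p∤choose-pred a k (≤-trans (n≤1+n k) sk≤M) dk
    where
    M = p ^ a ∸ 1
    pascal-step : choose (p ^ a) (suc k) ≡ choose M k + choose M (suc k)
    pascal-step = subst (λ z → choose z (suc k) ≡ choose M k + choose M (suc k)) (sym (p^a≡suc a)) refl
    dsum : p ∣ choose M k + choose M (suc k)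
    dsum = subst (p ∣_) pascal-step
             (p∣choose a (suc k) (s≤s z≤n) (subst (suc k <_) (sym (p^a≡suc a)) (s≤s sk≤M)))
    dk : p ∣ choose M k
    dk = ∣m+n∣m⇒∣n (subst (p ∣_) (+-comm (choose M k) _) dsum) d

  unitPart : ℕ → ℕ → ℕ
  unitPart a b = choose (p ^ a ∸ 1) (p ^ b ∸ 1)

  choose-pow-pow : ∀ a b → b ≤ a → choose (p ^ a) (p ^ b) ≡ p ^ (a ∸ b) * unitPart a b
  choose-pow-pow a b b≤a = *-cancelˡ-≡ _ _ (p ^ b) {{m^n≢0 p b}} (begin
      p ^ b * choose (p ^ a) (p ^ b) ≡⟨ absorption⁺ (p ^ a) (p ^ b) (m^n>0 p a) (m^n>0 p b) ⟩
      p ^ a * u                      ≡⟨ cong (_* u) (trans (cong (p ^_) (sym (m+[n∸m]≡n b≤a)))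
                                                           (^-distribˡ-+-* p b (a ∸ b))) ⟩
      p ^ b * p ^ (a ∸ b) * u        ≡⟨ *-assoc (p ^ b) _ u ⟩
      p ^ b * (p ^ (a ∸ b) * u)      ∎)
    where
    open ≡-Reasoning
    u = unitPart a b

  unitPart-unit : ∀ a b → b ≤ a → ¬ (p ∣ unitPart a b)
  unitPart-unit a b b≤a = p∤choose-pred a (p ^ b ∸ 1) (∸-monoˡ-≤ 1 (^-monoʳ-≤ p b≤a))

  not-∣-pow-unit : ∀ s j u → s ≤ j → ¬ (p ∣ u) → ¬ (p ^ suc j ∣ p ^ s * u)
  not-∣-pow-unit s j u s≤j p∤u d = p∤u (*-cancelˡ-∣ (p ^ s) {{m^n≢0 p s}} d')
    where
    d' : p ^ s * p ∣ p ^ s * u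
    d' = ∣-trans (subst (_∣ p ^ suc j) (*-comm p (p ^ s)) (^-monoʳ-∣ (s≤s s≤j))) d

  choose-pow-pow-∤ : ∀ a b j → b ≤ a → a ∸ b ≤ j → ¬ (p ^ suc j ∣ choose (p ^ a) (p ^ b))
  choose-pow-pow-∤ a b j b≤a le d =
    not-∣-pow-unit (a ∸ b) j _ le (unitPart-unit a b b≤a) (subst (p ^ suc j ∣_) (choose-pow-pow a b b≤a) d)

module ModN (N : ℕ) .{{_ : NonZero N}} where
  infix 4 _≅_
  _≅_ : ℕ → ℕ → Set
  a ≅ b = a ≡[mod N ] b

  ≅-refl : ∀ {a} → a ≅ a
  ≅-refl = refl

  ≅-sym : ∀ {a b} → a ≅ b → b ≅ a
  ≅-sym = sym

  ≅-trans : ∀ {a b c} → a ≅ b → b ≅ c → a ≅ c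
  ≅-trans = trans

  ≡⇒≅ : ∀ {a b} → a ≡ b → a ≅ b
  ≡⇒≅ refl = refl

  ≅-+ : ∀ {a a' b b'} → a ≅ a' → b ≅ b' → a + b ≅ a' + b'
  ≅-+ {a} {a'} {b} {b'} e f = begin
      (a + b) % N                 ≡⟨ %-distribˡ-+ a b N ⟩
      ((a % N) + (b % N)) % N     ≡⟨ cong₂ (λ x y → (x + y) % N) e f ⟩
      ((a' % N) + (b' % N)) % N   ≡⟨ sym (%-distribˡ-+ a' b' N) ⟩
      (a' + b') % N ∎
    where open ≡-Reasoning

  ≅-* : ∀ {a a' b b'} → a ≅ a' → b ≅ b' → a * b ≅ a' * b'
  ≅-* {a} {a'} {b} {b'} e f = begin
      (a * b) % N                 ≡⟨ %-distribˡ-* a b N ⟩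
      ((a % N) * (b % N)) % N     ≡⟨ cong₂ (λ x y → (x * y) % N) e f ⟩
      ((a' % N) * (b' % N)) % N   ≡⟨ sym (%-distribˡ-* a' b' N) ⟩
      (a' * b') % N ∎
    where open ≡-Reasoning

  ∣⇒≅0 : ∀ {a} → N ∣ a → a ≅ 0
  ∣⇒≅0 {a} d = trans (n∣m⇒m%n≡0 a N d) (sym (n∣m⇒m%n≡0 0 N (N ∣0)))

  ≅0⇒∣ : ∀ {a} → a ≅ 0 → N ∣ a
  ≅0⇒∣ {a} e = m%n≡0⇒n∣m a N (trans e (n∣m⇒m%n≡0 0 N (N ∣0)))

  -- Addition can be cancelled modulo N (ℕ has no negatives, so we add the
  -- complement N ∸ s % N of s instead of subtracting s).
  ≅-cancel+ : ∀ {a b s} → a + s ≅ b + s → a ≅ b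
  ≅-cancel+ {a} {b} {s} e = ≅-trans (≅-sym (drop a)) (≅-trans (≅-+ e (≅-refl {k})) (drop b))
    where
    k = N ∸ s % N
    s+k≅0 : s + k ≅ 0
    s+k≅0 = ∣⇒≅0 (subst (N ∣_) (sym eq) (n∣m*n (suc (s / N))))
      where
      eq : s + k ≡ N + s / N * N
      eq = begin
          s + k                   ≡⟨ cong (_+ k) (m≡m%n+[m/n]*n s N) ⟩
          (s % N + s / N * N) + k ≡⟨ +-assoc (s % N) _ k ⟩
          s % N + (s / N * N + k) ≡⟨ cong (s % N +_) (+-comm (s / N * N) k) ⟩
          s % N + (k + s / N * N) ≡⟨ sym (+-assoc (s % N) k _) ⟩
          (s % N + k) + s / N * N ≡⟨ cong (_+ s / N * N) (m+[n∸m]≡n (m%n≤n s N)) ⟩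
          N + s / N * N           ∎
        where open ≡-Reasoning
    drop : ∀ x → x + s + k ≅ x
    drop x = ≅-trans (≡⇒≅ (+-assoc x s k)) (≅-trans (≅-+ (≅-refl {x}) s+k≅0) (≡⇒≅ (+-identityʳ x)))

  ≅-resp-∣ : ∀ {d a b} → d ∣ N → a ≅ b → d ∣ a → d ∣ b
  ≅-resp-∣ {d} {a} {b} dN e da = ∣n∣m%n⇒∣m dN (subst (d ∣_) e (%-presˡ-∣ da dN))

Σ-cong : ∀ n {f g : Fin n → ℕ} → (∀ k → f k ≡ g k) → Σᶠ n f ≡ Σᶠ n g
Σ-cong zero    e = refl
Σ-cong (suc n) e = cong₂ _+_ (e zero) (Σ-cong n (λ k → e (suc k)))

Σ-zero : ∀ n {f : Fin n → ℕ} → (∀ k → f k ≡ 0) → Σᶠ n f ≡ 0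
Σ-zero zero    e = refl
Σ-zero (suc n) e = cong₂ _+_ (e zero) (Σ-zero n (λ k → e (suc k)))

Σ-+ : ∀ n (f g : Fin n → ℕ) → Σᶠ n (λ k → f k + g k) ≡ Σᶠ n f + Σᶠ n g
Σ-+ zero    f g = refl
Σ-+ (suc n) f g = trans (cong (f zero + g zero +_) (Σ-+ n (λ k → f (suc k)) (λ k → g (suc k))))
                        (+-+-interchange (f zero) (g zero) _ _)
  where open import Algebra.Properties.CommutativeSemigroup +-commutativeSemigroup
          using () renaming (interchange to +-+-interchange)

Σ-*ˡ : ∀ n a (f : Fin n → ℕ) → Σᶠ n (λ k → a * f k) ≡ a * Σᶠ n f
Σ-*ˡ zero    a f = sym (*-zeroʳ a)
Σ-*ˡ (suc n) a f = trans (cong (a * f zero +_) (Σ-*ˡ n a (λ k → f (suc k))))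
                         (sym (*-distribˡ-+ a (f zero) _))

Σ-*ʳ : ∀ n a (f : Fin n → ℕ) → Σᶠ n (λ k → f k * a) ≡ Σᶠ n f * a
Σ-*ʳ n a f = trans (Σ-cong n (λ k → *-comm (f k) a)) (trans (Σ-*ˡ n a f) (*-comm a _))

Σ-swap : ∀ n m (f : Fin n → Fin m → ℕ) →
         Σᶠ n (λ a → Σᶠ m (λ b → f a b)) ≡ Σᶠ m (λ b → Σᶠ n (λ a → f a b))
Σ-swap zero    m f = sym (Σ-zero m (λ _ → refl))
Σ-swap (suc n) m f = trans (cong (Σᶠ m (f zero) +_) (Σ-swap n m (λ a b → f (suc a) b)))
                           (sym (Σ-+ m (f zero) (λ b → Σᶠ n (λ a → f (suc a) b))))

Σ-single : ∀ n (f : Fin n → ℕ) (r : Fin n) → (∀ k → k ≢ r → f k ≡ 0) → Σᶠ n f ≡ f r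
Σ-single (suc n) f zero e =
  trans (cong (f zero +_) (Σ-zero n (λ k → e (suc k) (λ ())))) (+-identityʳ _)
Σ-single (suc n) f (suc r) e =
  trans (cong (_+ Σᶠ n (λ k → f (suc k))) (e zero (λ ())))
        (Σ-single n (λ k → f (suc k)) r (λ k k≢r → e (suc k) (λ eq → k≢r (FP.suc-injective eq))))

Σ-∣ : ∀ n {d} (f : Fin n → ℕ) → (∀ k → d ∣ f k) → d ∣ Σᶠ n f
Σ-∣ zero    {d} f e = d ∣0
Σ-∣ (suc n) f e = ∣m∣n⇒∣m+n (e zero) (Σ-∣ n (λ k → f (suc k)) (λ k → e (suc k)))

Σᴺ : ℕ → (ℕ → ℕ) → ℕ
Σᴺ n f = Σᶠ n (λ k → f (toℕ k))

Σᴺ-last : ∀ n (f : ℕ → ℕ) → Σᴺ (suc n) f ≡ Σᴺ n f + f n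
Σᴺ-last zero    f = +-identityʳ (f 0)
Σᴺ-last (suc n) f = trans (cong (f 0 +_) (Σᴺ-last n (λ k → f (suc k)))) (sym (+-assoc (f 0) _ _))

Σᴺ-single : ∀ n (f : ℕ → ℕ) l → l < n → (∀ k → k ≢ l → f k ≡ 0) → Σᴺ n f ≡ f l
Σᴺ-single n f l l<n e =
  trans (Σ-single n _ (fromℕ< l<n) (λ k k≢ → e (toℕ k) (λ eq → k≢ (toℕ-injective (trans eq (sym (toℕ-fromℕ< l<n)))))))
        (cong f (toℕ-fromℕ< l<n))

δ-refl : ∀ {n} (r : Fin n) → δ r r ≡ 1
δ-refl r with r ≟ r
... | yes _ = refl
... | no ne = ⊥-elim (ne refl)

δ-≢ : ∀ {n} {r c : Fin n} → r ≢ c → δ r c ≡ 0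
δ-≢ {r = r} {c} ne with r ≟ c
... | yes eq = ⊥-elim (ne eq)
... | no _   = refl

δ-sym : ∀ {n} (r c : Fin n) → δ r c ≡ δ c r
δ-sym r c with r ≟ c
... | yes refl = sym (δ-refl r)
... | no ne    = sym (δ-≢ (λ eq → ne (sym eq)))

δ-< : ∀ {n} {r c : Fin n} → toℕ r < toℕ c → δ r c ≡ 0
δ-< lt = δ-≢ (λ e → <⇒≢ lt (cong toℕ e))

δ-> : ∀ {n} {r c : Fin n} → toℕ c < toℕ r → δ r c ≡ 0
δ-> lt = δ-≢ (λ e → <⇒≢ lt (sym (cong toℕ e)))

Σ-δˡ : ∀ n (r : Fin n) (f : Fin n → ℕ) → Σᶠ n (λ k → δ r k * f k) ≡ f r
Σ-δˡ n r f = trans (Σ-single n _ r (λ k k≢r → cong (_* f k) (δ-≢ (λ eq → k≢r (sym eq)))))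
                   (trans (cong (_* f r) (δ-refl r)) (*-identityˡ (f r)))

Σ-δʳ : ∀ n (c : Fin n) (f : Fin n → ℕ) → Σᶠ n (λ k → f k * δ k c) ≡ f c
Σ-δʳ n c f = trans (Σ-cong n (λ k → trans (*-comm (f k) _) (cong (_* f k) (δ-sym k c)))) (Σ-δˡ n c f)

infix 4 _≋_
_≋_ : ∀ {n} → Mat n → Mat n → Set
A ≋ B = ∀ r c → A r c ≡ B r c

infixl 6 _⊕_
_⊕_ : ∀ {n} → Mat n → Mat n → Mat n
(A ⊕ B) r c = A r c + B r c

infixl 7 _⊛_
_⊛_ : ∀ {n} → ℕ → Mat n → Mat n
(s ⊛ A) r c = s * A r c

𝟎 : ∀ {n} → Mat n
𝟎 r c = 0

E : ∀ {n} → Fin n → Fin n → Mat n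
E a b r c = δ a r * δ b c

≋-refl : ∀ {n} {A : Mat n} → A ≋ A
≋-refl r c = refl

≋-sym : ∀ {n} {A B : Mat n} → A ≋ B → B ≋ A
≋-sym e r c = sym (e r c)

≋-trans : ∀ {n} {A B C : Mat n} → A ≋ B → B ≋ C → A ≋ C
≋-trans e f r c = trans (e r c) (f r c)

·-cong : ∀ {n} {A A' B B' : Mat n} → A ≋ A' → B ≋ B' → A · B ≋ A' · B'
·-cong {n} e f r c = Σ-cong n (λ k → cong₂ _*_ (e r k) (f k c))

·-identityˡ : ∀ {n} (A : Mat n) → 𝐈 · A ≋ A
·-identityˡ {n} A r c = Σ-δˡ n r (λ k → A k c)

·-identityʳ : ∀ {n} (A : Mat n) → A · 𝐈 ≋ A
·-identityʳ {n} A r c = Σ-δʳ n c (λ k → A r k)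

·-assoc : ∀ {n} (A B C : Mat n) → (A · B) · C ≋ A · (B · C)
·-assoc {n} A B C r c = begin
    Σᶠ n (λ k → Σᶠ n (λ s → A r s * B s k) * C k c)
  ≡⟨ Σ-cong n (λ k → sym (Σ-*ʳ n (C k c) (λ s → A r s * B s k))) ⟩
    Σᶠ n (λ k → Σᶠ n (λ s → A r s * B s k * C k c))
  ≡⟨ Σ-swap n n _ ⟩
    Σᶠ n (λ s → Σᶠ n (λ k → A r s * B s k * C k c))
  ≡⟨ Σ-cong n (λ s → trans (Σ-cong n (λ k → *-assoc (A r s) _ _)) (Σ-*ˡ n (A r s) (λ k → B s k * C k c))) ⟩
    Σᶠ n (λ s → A r s * Σᶠ n (λ k → B s k * C k c))
  ∎
  where open ≡-Reasoning

·-distribˡ : ∀ {n} (A B C : Mat n) → A · (B ⊕ C) ≋ A · B ⊕ A · C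
·-distribˡ {n} A B C r c = trans (Σ-cong n (λ k → *-distribˡ-+ (A r k) (B k c) (C k c))) (Σ-+ n _ _)

·-distribʳ : ∀ {n} (A B C : Mat n) → (A ⊕ B) · C ≋ A · C ⊕ B · C
·-distribʳ {n} A B C r c = trans (Σ-cong n (λ k → *-distribʳ-+ (C k c) (A r k) (B r k))) (Σ-+ n _ _)

·-⊛ˡ : ∀ {n} s (A B : Mat n) → (s ⊛ A) · B ≋ s ⊛ (A · B)
·-⊛ˡ {n} s A B r c = trans (Σ-cong n (λ k → *-assoc s (A r k) (B k c))) (Σ-*ˡ n s _)

·-⊛ʳ : ∀ {n} s (A B : Mat n) → A · (s ⊛ B) ≋ s ⊛ (A · B)
·-⊛ʳ {n} s A B r c = trans (Σ-cong n (λ k → x∙yz≈y∙xz (A r k) s (B k c))) (Σ-*ˡ n s _)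

⊛-· : ∀ {n} s t (A B : Mat n) → (s ⊛ A) · (t ⊛ B) ≋ s ⊛ (t ⊛ (A · B))
⊛-· s t A B r c = trans (·-⊛ˡ s A (t ⊛ B) r c) (cong (s *_) (·-⊛ʳ t A B r c))

I+·I+ : ∀ {n} (A B : Mat n) → (𝐈 ⊕ A) · (𝐈 ⊕ B) ≋ 𝐈 ⊕ (A ⊕ B ⊕ A · B)
I+·I+ A B r c = begin
    ((𝐈 ⊕ A) · (𝐈 ⊕ B)) r c
  ≡⟨ ·-distribˡ (𝐈 ⊕ A) 𝐈 B r c ⟩
    ((𝐈 ⊕ A) · 𝐈) r c + ((𝐈 ⊕ A) · B) r c
  ≡⟨ cong₂ _+_ (·-identityʳ (𝐈 ⊕ A) r c) (·-distribʳ 𝐈 A B r c) ⟩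
    (δ r c + A r c) + ((𝐈 · B) r c + (A · B) r c)
  ≡⟨ cong (λ z → (δ r c + A r c) + (z + (A · B) r c)) (·-identityˡ B r c) ⟩
    (δ r c + A r c) + (B r c + (A · B) r c)
  ≡⟨ +-assoc (δ r c) (A r c) _ ⟩
    δ r c + (A r c + (B r c + (A · B) r c))
  ≡⟨ cong (δ r c +_) (sym (+-assoc (A r c) (B r c) _)) ⟩
    δ r c + (A r c + B r c + (A · B) r c)
  ∎
  where open ≡-Reasoning

E·E : ∀ {n} (a b c d : Fin n) → E a b · E c d ≋ δ b c ⊛ E a d
E·E {n} a b c d r c' = begin
    Σᶠ n (λ k → δ a r * δ b k * (δ c k * δ d c'))
  ≡⟨ Σ-cong n (λ k → regroup (δ a r) (δ b k) (δ c k) (δ d c')) ⟩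
    Σᶠ n (λ k → δ b k * (δ c k * (δ a r * δ d c')))
  ≡⟨ Σ-δˡ n b (λ k → δ c k * (δ a r * δ d c')) ⟩
    δ c b * (δ a r * δ d c')
  ≡⟨ cong (_* (δ a r * δ d c')) (δ-sym c b) ⟩
    δ b c * (δ a r * δ d c')
  ∎
  where
  open ≡-Reasoning
  open +-*-Solver
  regroup : ∀ x y z w → x * y * (z * w) ≡ y * (z * (x * w))
  regroup = solve 4 (λ x y z w → x :* y :* (z :* w) := y :* (z :* (x :* w))) refl

E·E-≢ : ∀ {n} {a b c d : Fin n} → b ≢ c → E a b · E c d ≋ 𝟎
E·E-≢ {a = a} {b} {c} {d} ne r c' = trans (E·E a b c d r c') (cong (_* E a d r c') (δ-≢ ne))

E·E-≡ : ∀ {n} (a b d : Fin n) → E a b · E b d ≋ E a d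
E·E-≡ a b d r c' = trans (E·E a b b d r c') (trans (cong (_* E a d r c') (δ-refl b)) (*-identityˡ _))

E·ˡ : ∀ {n} (a b : Fin n) (M : Mat n) r c → (E a b · M) r c ≡ δ a r * M b c
E·ˡ {n} a b M r c =
  trans (Σ-cong n (λ k → *-assoc (δ a r) (δ b k) (M k c)))
        (trans (Σ-*ˡ n (δ a r) _) (cong (δ a r *_) (Σ-δˡ n b (λ k → M k c))))

·Eʳ : ∀ {n} (a b : Fin n) (M : Mat n) r c → (M · E a b) r c ≡ M r a * δ b c
·Eʳ {n} a b M r c =
  trans (Σ-cong n (λ k → sym (*-assoc (M r k) (δ a k) (δ b c))))
        (trans (Σ-*ʳ n (δ b c) (λ k → M r k * δ a k))
               (cong (_* δ b c) (trans (Σ-cong n (λ k → cong (M r k *_) (δ-sym a k))) (Σ-δʳ n a (λ k → M r k)))))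

transv : ∀ {n} → ℕ → Mat n → Mat n
transv s A = 𝐈 ⊕ s ⊛ A

transv-0 : ∀ {n} (A : Mat n) → 𝐈 ≋ transv 0 A
transv-0 A r c = sym (+-identityʳ (δ r c))

transv-+ : ∀ {n} s t (A : Mat n) → A · A ≋ 𝟎 → transv s A · transv t A ≋ transv (s + t) A
transv-+ s t A A²≡0 r c = trans (I+·I+ (s ⊛ A) (t ⊛ A) r c) (cong (δ r c +_) eq)
  where
  st0 : ((s ⊛ A) · (t ⊛ A)) r c ≡ 0
  st0 = trans (⊛-· s t A A r c) (trans (cong (λ z → s * (t * z)) (A²≡0 r c))
              (trans (cong (s *_) (*-zeroʳ t)) (*-zeroʳ s)))
  eq : s * A r c + t * A r c + ((s ⊛ A) · (t ⊛ A)) r c ≡ (s + t) * A r c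
  eq = trans (cong (s * A r c + t * A r c +_) st0)
             (trans (+-identityʳ _) (sym (*-distribʳ-+ (A r c) s t)))

transv-^ : ∀ {n} s (A : Mat n) → A · A ≋ 𝟎 → ∀ k → transv s A ^ᴹ k ≋ transv (k * s) A
transv-^ s A A²≡0 zero    = transv-0 A
transv-^ s A A²≡0 (suc k) =
  ≋-trans (·-cong (≋-refl {A = transv s A}) (transv-^ s A A²≡0 k)) (transv-+ s (k * s) A A²≡0)

module MatN (N : ℕ) .{{_ : NonZero N}} where
  open ModN N public

  infix 4 _≈_
  _≈_ : ∀ {n} → Mat n → Mat n → Set
  A ≈ B = MatEq N A B

  ≈-refl : ∀ {n} {A : Mat n} → A ≈ A
  ≈-refl r c = refl

  ≈-sym : ∀ {n} {A B : Mat n} → A ≈ B → B ≈ A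
  ≈-sym e r c = sym (e r c)

  ≈-trans : ∀ {n} {A B C : Mat n} → A ≈ B → B ≈ C → A ≈ C
  ≈-trans e f r c = trans (e r c) (f r c)

  ≋⇒≈ : ∀ {n} {A B : Mat n} → A ≋ B → A ≈ B
  ≋⇒≈ e r c = cong (_% N) (e r c)

  Σ-≅ : ∀ n {f g : Fin n → ℕ} → (∀ k → f k ≅ g k) → Σᶠ n f ≅ Σᶠ n g
  Σ-≅ zero    e = refl
  Σ-≅ (suc n) e = ≅-+ (e zero) (Σ-≅ n (λ k → e (suc k)))

  ·-≈ : ∀ {n} {A A' B B' : Mat n} → A ≈ A' → B ≈ B' → A · B ≈ A' · B'
  ·-≈ {n} e f r c = Σ-≅ n (λ k → ≅-* (e r k) (f k c))

  ^-≈ : ∀ {n} {A A' : Mat n} m → A ≈ A' → A ^ᴹ m ≈ A' ^ᴹ m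
  ^-≈ zero    e = ≈-refl
  ^-≈ (suc m) e = ·-≈ e (^-≈ m e)

  ≈-assoc : ∀ {n} (A B C : Mat n) → (A · B) · C ≈ A · (B · C)
  ≈-assoc A B C = ≋⇒≈ (·-assoc A B C)

  ·-cancel-inv : ∀ {n} {x x' : Mat n} (z : Mat n) → x' · x ≈ 𝐈 → x' · (x · z) ≈ z
  ·-cancel-inv {x = x} {x'} z x'x =
    ≈-trans (≈-sym (≈-assoc x' x z)) (≈-trans (·-≈ x'x (≈-refl {A = z})) (≋⇒≈ (·-identityˡ z)))

  commutator-assoc : ∀ {n} (g h g' h' : Mat n) → ((g' · h') · g) · h ≈ g' · (h' · (g · h))
  commutator-assoc g h g' h' = ≈-trans (≈-assoc (g' · h') g h) (≈-assoc g' h' (g · h))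

  transv-N : ∀ {n} s (A : Mat n) → N ∣ s → transv s A ≈ 𝐈
  transv-N s A d r c =
    ≅-trans (≅-+ (≅-refl {δ r c}) (≅-* (∣⇒≅0 d) ≅-refl)) (≡⇒≅ (+-identityʳ (δ r c)))

  transv-inv : ∀ {n} (A : Mat n) → A · A ≋ 𝟎 → transv 1 A · transv (N ∸ 1) A ≈ 𝐈
  transv-inv A A²≡0 = ≈-trans (≋⇒≈ (transv-+ 1 (N ∸ 1) A A²≡0))
    (transv-N (1 + (N ∸ 1)) A (subst (N ∣_) (sym (m+[n∸m]≡n (>-nonZero⁻¹ N))) ∣-refl))

  transv-inv′ : ∀ {n} (A : Mat n) → A · A ≋ 𝟎 → transv (N ∸ 1) A · transv 1 A ≈ 𝐈
  transv-inv′ A A²≡0 = ≈-trans (≋⇒≈ (transv-+ (N ∸ 1) 1 A A²≡0))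
    (transv-N (N ∸ 1 + 1) A (subst (N ∣_) (sym (m∸n+n≡m (>-nonZero⁻¹ N))) ∣-refl))

Gen-ind : ∀ {N} .{{_ : NonZero N}} {n} {S : Pred n} (H : Pred n) →
          (∀ x → S x → H x) → H 𝐈 →
          (∀ {x y} → H x → H y → H (x · y)) →
          (∀ {x y} → H x → MatEq N (x · y) 𝐈 → H y) →
          (∀ {x y} → MatEq N x y → H x → H y) →
          ∀ {x} → Gen N n S x → H x
Gen-ind H hs h1 hm hi hr (gen s)    = hs _ s
Gen-ind H hs h1 hm hi hr one        = h1
Gen-ind H hs h1 hm hi hr (mul a b)  = hm (Gen-ind H hs h1 hm hi hr a) (Gen-ind H hs h1 hm hi hr b)
Gen-ind H hs h1 hm hi hr (inv a e)  = hi (Gen-ind H hs h1 hm hi hr a) e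
Gen-ind H hs h1 hm hi hr (resp e a) = hr e (Gen-ind H hs h1 hm hi hr a)

Gen-^ : ∀ {N} .{{_ : NonZero N}} {n} {S : Pred n} {x} k → Gen N n S x → Gen N n S (x ^ᴹ k)
Gen-^ zero    g = one
Gen-^ (suc k) g = mul g (Gen-^ k g)

module Banded (N : ℕ) .{{_ : NonZero N}} (n : ℕ) where
  open MatN N

  Agree : ℕ → Mat n → Mat n → Set
  Agree K A B = ∀ r c → toℕ c < toℕ r + K → A r c ≅ B r c

  -- x is K-banded: it agrees with I on the band, i.e. it is unipotent upper
  -- triangular with its first K - 1 superdiagonals zero.
  Bd : ℕ → Mat n → Set
  Bd K x = Agree K x 𝐈

  ≈⇒Agree : ∀ {K A B} → A ≈ B → Agree K A B
  ≈⇒Agree e r c _ = e r c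

  Agree-trans : ∀ {K A B C} → Agree K A B → Agree K B C → Agree K A C
  Agree-trans e f r c lt = ≅-trans (e r c lt) (f r c lt)

  Agree-mono : ∀ {K K' A B} → K' ≤ K → Agree K A B → Agree K' A B
  Agree-mono {K} {K'} le e r c lt = e r c (<-≤-trans lt (+-monoʳ-≤ (toℕ r) le))

  Agree-all : ∀ {A B} → Agree n A B → A ≈ B
  Agree-all ag r c = ag r c (≤-trans (toℕ<n c) (m≤n+m n (toℕ r)))

  Bd1-diag : ∀ {A} → Bd 1 A → ∀ s → A s s ≅ 1
  Bd1-diag b s = ≅-trans (b s s (m<m+n (toℕ s) (s≤s z≤n))) (≡⇒≅ (δ-refl s))

  Bd1-lower : ∀ {A} → Bd 1 A → ∀ a b → toℕ b < toℕ a → A a b ≅ 0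
  Bd1-lower bA a b b<a = ≅-trans (bA a b (≤-trans b<a (m≤m+n (toℕ a) 1))) (≡⇒≅ (δ-> b<a))

  unip⇒Bd1 : ∀ {x} → Unipotent N n x → Bd 1 x
  unip⇒Bd1 {x} (lower , diag) r c lt with <-cmp (toℕ c) (toℕ r)
  ... | tri< c<r _ _ = ≅-trans (lower r c c<r) (≡⇒≅ (sym (δ-> c<r)))
  ... | tri≈ _ eq _ rewrite toℕ-injective eq = ≅-trans (diag r) (≡⇒≅ (sym (δ-refl r)))
  ... | tri> _ _ r<c = ⊥-elim (<⇒≱ lt (subst (_≤ toℕ c) (+-comm 1 (toℕ r)) r<c))

  Bd1⇒unip : ∀ {x} → Bd 1 x → Unipotent N n x
  Bd1⇒unip b = (λ r c c<r → Bd1-lower b r c c<r) , Bd1-diag b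

  Bd-· : ∀ {K x y} → 1 ≤ K → Bd K x → Bd K y → Bd K (x · y)
  Bd-· {K} {x} {y} 1≤K bx by r c lt =
    ≅-trans (Σ-≅ n term) (≅-trans (≡⇒≅ (Σ-δˡ n r (λ s → y s c))) (by r c lt))
    where
    term : ∀ s → x r s * y s c ≅ δ r s * y s c
    term s with toℕ s <? toℕ r + K
    ... | yes s<r+K = ≅-* (bx r s s<r+K) ≅-refl
    ... | no s≮r+K  = ≅-trans (≅-* (≅-refl {x r s}) ysc)
                              (≡⇒≅ (trans (*-zeroʳ (x r s)) (sym (cong (_* y s c) (δ-< r<s)))))
      where
      c<s : toℕ c < toℕ s
      c<s = <-≤-trans lt (≮⇒≥ s≮r+K)
      r<s : toℕ r < toℕ s
      r<s = <-≤-trans (m<m+n (toℕ r) 1≤K) (≮⇒≥ s≮r+K)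
      ysc : y s c ≅ 0
      ysc = ≅-trans (by s c (≤-trans c<s (m≤m+n (toℕ s) K))) (≡⇒≅ (δ-> c<s))

  offDiag : Mat n → Mat n → Fin n → Fin n → ℕ
  offDiag U Y r c = Σᶠ n (λ s → (1 ∸ δ r s) * (U r s * Y s c))

  -- For U unipotent upper triangular, entry (r,c) of U·X only involves rows
  -- s ≥ r of X; so if X agrees with Y below row r it is X r c + offDiag U Y r c.
  row-expand : ∀ {U X Y} → Bd 1 U → ∀ r c → (∀ s → toℕ r < toℕ s → X s c ≅ Y s c) →
               (U · X) r c ≅ X r c + offDiag U Y r c
  row-expand {U} {X} {Y} bU r c below =
    ≅-trans (Σ-≅ n term) (≡⇒≅ (trans (Σ-+ n _ _) (cong (_+ offDiag U Y r c) (Σ-δˡ n r (λ _ → X r c)))))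
    where
    term : ∀ s → U r s * X s c ≅ δ r s * X r c + (1 ∸ δ r s) * (U r s * Y s c)
    term s with r ≟ s
    ... | yes refl = ≅-trans (≅-* (Bd1-diag bU r) ≅-refl) (≡⇒≅ (sym (+-identityʳ (1 * X r c))))
    ... | no r≢s with <-cmp (toℕ s) (toℕ r)
    ...   | tri< s<r _ _ = ≅-trans (≅-* (Bd1-lower bU r s s<r) ≅-refl)
                             (≅-trans (≅-* (≅-sym (Bd1-lower bU r s s<r)) ≅-refl) (≡⇒≅ (sym (+-identityʳ _))))
    ...   | tri≈ _ eq _  = ⊥-elim (r≢s (sym (toℕ-injective eq)))
    ...   | tri> _ _ r<s = ≅-trans (≅-* (≅-refl {U r s}) (below s r<s)) (≡⇒≅ (sym (+-identityʳ _)))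

  cancel : ∀ {K U X Y} → Bd 1 U → Agree K (U · X) (U · Y) → Agree K X Y
  cancel {K} {U} {X} {Y} bU e r c lt = go n r (m≤n+m n (toℕ r)) c lt
    where
    -- downward induction on the row: t bounds the number of rows below r
    go : ∀ t (r : Fin n) → n ≤ toℕ r + t → ∀ c → toℕ c < toℕ r + K → X r c ≅ Y r c
    go zero    r le c lt = ⊥-elim (<⇒≱ (toℕ<n r) (subst (n ≤_) (+-identityʳ (toℕ r)) le))
    go (suc t) r le c lt =
      ≅-cancel+ (≅-trans (≅-sym (row-expand {U} {X} {Y} bU r c below))
                (≅-trans (e r c lt) (row-expand {U} {Y} {Y} bU r c (λ _ _ → ≅-refl))))
      where
      below : ∀ s → toℕ r < toℕ s → X s c ≅ Y s c
      below s r<s = go t s (≤-trans le (subst (_≤ toℕ s + t) (sym (+-suc (toℕ r) t)) (+-monoˡ-≤ t r<s)))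
                           c (<-≤-trans lt (+-monoˡ-≤ K (<⇒≤ r<s)))

  Bd-inv : ∀ {K x y} → 1 ≤ K → Bd K x → x · y ≈ 𝐈 → Bd K y
  Bd-inv {K} {x} {y} 1≤K bx e = cancel (Agree-mono 1≤K bx) agree
    where
    agree : Agree K (x · y) (x · 𝐈)
    agree r c lt = ≅-trans (e r c) (≅-trans (≅-sym (bx r c lt)) (≡⇒≅ (sym (·-identityʳ x r c))))

  module _ {k g h} (1≤k : 1 ≤ k) (bg : Bd 1 g) (bh : Bd k h) {r c : Fin n}
           (r<c : toℕ r < toℕ c) (lt : toℕ c < toℕ r + suc k) where

    private
      δrc≡0 : δ r c ≡ 0
      δrc≡0 = δ-< r<c

      h-off : ∀ s → toℕ c < toℕ s + k → s ≢ c → h s c ≅ 0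
      h-off s lt' s≢c = ≅-trans (bh s c lt') (≡⇒≅ (δ-≢ s≢c))

    ·-in-band : (g · h) r c ≅ h r c + g r c
    ·-in-band = ≅-trans (Σ-≅ n term)
      (≡⇒≅ (trans (Σ-+ n _ _) (cong₂ _+_ (Σ-δˡ n r (λ s → h s c)) (Σ-δʳ n c (λ s → g r s)))))
      where
      term : ∀ s → g r s * h s c ≅ δ r s * h s c + g r s * δ s c
      term s with r ≟ s
      ... | yes refl = ≅-trans (≅-* (Bd1-diag bg r) ≅-refl)
                         (≡⇒≅ (sym (trans (cong (1 * h r c +_) (trans (cong (g r r *_) δrc≡0) (*-zeroʳ (g r r))))
                                          (+-identityʳ _))))
      ... | no r≢s with s ≟ c
      ...   | yes refl = ≅-* (≅-refl {g r s}) (Bd1-diag (Agree-mono 1≤k bh) s)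
      ...   | no s≢c with <-cmp (toℕ s) (toℕ r)
      ...     | tri< s<r _ _ = ≅-trans (≅-* (Bd1-lower bg r s s<r) ≅-refl) (≡⇒≅ (sym (*-zeroʳ (g r s))))
      ...     | tri≈ _ eq _  = ⊥-elim (r≢s (sym (toℕ-injective eq)))
      ...     | tri> _ _ r<s = ≅-* (≅-refl {g r s}) (h-off s lt' s≢c)
        where
        lt' : toℕ c < toℕ s + k
        lt' = <-≤-trans lt (subst (_≤ toℕ s + k) (sym (+-suc (toℕ r) k)) (+-monoˡ-≤ k r<s))

    ·-in-band′ : (h · g) r c ≅ h r c + g r c
    ·-in-band′ = ≅-trans (Σ-≅ n term)
      (≡⇒≅ (trans (Σ-+ n _ _) (cong₂ _+_ (Σ-δʳ n c (λ s → h r s)) (Σ-δˡ n r (λ s → g s c)))))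
      where
      term : ∀ s → h r s * g s c ≅ h r s * δ s c + δ r s * g s c
      term s with r ≟ s
      ... | yes refl = ≅-trans (≅-* (Bd1-diag (Agree-mono 1≤k bh) r) ≅-refl)
                         (≡⇒≅ (sym (cong (_+ 1 * g r c) (trans (cong (h r r *_) δrc≡0) (*-zeroʳ (h r r))))))
      ... | no r≢s with s ≟ c
      ...   | yes refl = ≅-trans (≅-* (≅-refl {h r s}) (Bd1-diag bg s)) (≡⇒≅ (sym (+-identityʳ _)))
      ...   | no s≢c with toℕ s <? toℕ r + k
      ...     | yes s<r+k = ≅-trans (≅-* (≅-trans (bh r s s<r+k) (≡⇒≅ (δ-≢ r≢s))) ≅-refl)
                                    (≡⇒≅ (sym (trans (+-identityʳ _) (*-zeroʳ (h r s)))))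
      ...     | no s≮r+k  = ≅-trans (≅-* (≅-refl {h r s}) (Bd1-lower bg s c c<s)) (≡⇒≅ (sym (+-identityʳ _)))
        where
        c<s : toℕ c < toℕ s
        c<s = ≤∧≢⇒< (≤-trans (≤-pred (subst (toℕ c <_) (+-suc (toℕ r) k) lt)) (≮⇒≥ s≮r+k))
                    (λ eq → s≢c (sym (toℕ-injective eq)))

  ·-comm-lower : ∀ {g h} → Bd 1 g → Bd 1 h → ∀ r c → toℕ c ≤ toℕ r → (g · h) r c ≅ (h · g) r c
  ·-comm-lower bg bh r c c≤r = ≅-trans (Bd-· (s≤s z≤n) bg bh r c c<r+1) (≅-sym (Bd-· (s≤s z≤n) bh bg r c c<r+1))
    where
    c<r+1 : toℕ c < toℕ r + 1
    c<r+1 = subst (toℕ c <_) (+-comm 1 (toℕ r)) (s≤s c≤r)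

  commute-in-band : ∀ {k g h} → 1 ≤ k → Bd 1 g → Bd k h → Agree (suc k) (g · h) (h · g)
  commute-in-band {k} {g} {h} 1≤k bg bh r c lt with <-cmp (toℕ r) (toℕ c)
  ... | tri< r<c _ _ = ≅-trans (·-in-band 1≤k bg bh r<c lt) (≅-sym (·-in-band′ 1≤k bg bh r<c lt))
  ... | tri≈ _ eq _  = ·-comm-lower bg (Agree-mono 1≤k bh) r c (≤-reflexive (sym eq))
  ... | tri> _ _ c<r = ·-comm-lower bg (Agree-mono 1≤k bh) r c (<⇒≤ c<r)

  -- The commutator [g,h] = g⁻¹h⁻¹gh of a 1-banded g and a k-banded h is
  -- (k+1)-banded: (hg)·[g,h] = gh, and gh, hg agree on the wider band.
  commutator-Bd : ∀ {k g h g' h' x} → 1 ≤ k → Bd 1 g → Bd k h → g · g' ≈ 𝐈 → h · h' ≈ 𝐈 →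
                  x ≈ (((g' · h') · g) · h) → Bd (suc k) x
  commutator-Bd {k} {g} {h} {g'} {h'} {x} 1≤k bg bh gg' hh' ex =
    cancel (Bd-· (s≤s z≤n) (Agree-mono 1≤k bh) bg) agree
    where
    hg·x≈gh : (h · g) · x ≈ g · h
    -- (hg)(g'h'gh) = h(g(g'(h'(gh)))) = h(h'(gh)) = gh
    hg·x≈gh = ≈-trans (·-≈ (≈-refl {A = h · g}) (≈-trans ex (commutator-assoc g h g' h')))
              (≈-trans (≈-assoc h g _)
              (≈-trans (·-≈ (≈-refl {A = h}) (·-cancel-inv {x = g'} {g} (h' · (g · h)) gg'))
                       (·-cancel-inv {x = h'} {h} (g · h) hh')))
    agree : Agree (suc k) ((h · g) · x) ((h · g) · 𝐈)
    agree = Agree-trans (≈⇒Agree hg·x≈gh)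
            (Agree-trans (commute-in-band 1≤k bg bh) (≈⇒Agree (≋⇒≈ (≋-sym (·-identityʳ (h · g))))))

  LCS⊆Bd : ∀ k {x} → LCS N n (suc k) x → Bd (suc k) x
  LCS⊆Bd zero    u = unip⇒Bd1 u
  LCS⊆Bd (suc k) = Gen-ind (Bd (suc (suc k)))
    (λ x (g , h , g' , h' , ug , lh , gg' , hh' , ex) →
       commutator-Bd (s≤s z≤n) (unip⇒Bd1 ug) (LCS⊆Bd k lh) gg' hh' ex)
    (λ r c _ → refl) (Bd-· (s≤s z≤n)) (Bd-inv (s≤s z≤n)) (λ e b → Agree-trans (≈⇒Agree (≈-sym e)) b)

  -- Each term of the lower central series contains I and is closed under
  -- products and congruence (for k ≥ 1 by definition, for 𝕌 itself via bands).
  LCS-one : ∀ k → LCS N n (suc k) 𝐈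
  LCS-one zero    = Bd1⇒unip (λ r c _ → refl)
  LCS-one (suc k) = one

  LCS-· : ∀ k {x y} → LCS N n (suc k) x → LCS N n (suc k) y → LCS N n (suc k) (x · y)
  LCS-· zero    a b = Bd1⇒unip (Bd-· (s≤s z≤n) (unip⇒Bd1 a) (unip⇒Bd1 b))
  LCS-· (suc k) a b = mul a b

  LCS-resp : ∀ k {x y} → x ≈ y → LCS N n (suc k) x → LCS N n (suc k) y
  LCS-resp zero    e u = Bd1⇒unip (Agree-trans (≈⇒Agree (≈-sym e)) (unip⇒Bd1 u))
  LCS-resp (suc k) e u = resp e u

pascal : ∀ m (y : ℕ → ℕ) →
         Σᴺ (suc m) (λ l → choose m l * y l) + Σᴺ (suc m) (λ l → choose m l * y (suc l))
         ≡ Σᴺ (suc (suc m)) (λ l → choose (suc m) l * y l)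
pascal m y = begin
    (1 * y 0 + S₂) + S₁
  ≡⟨ +-assoc (1 * y 0) S₂ S₁ ⟩
    1 * y 0 + (S₂ + S₁)
  ≡⟨ cong (1 * y 0 +_) (+-comm S₂ S₁) ⟩
    1 * y 0 + (S₁ + S₂)
  ≡⟨ cong (λ z → 1 * y 0 + (S₁ + z)) (sym S₂-extend) ⟩
    1 * y 0 + (S₁ + Σᴺ (suc m) (λ l → choose m (suc l) * y (suc l)))
  ≡⟨ cong (1 * y 0 +_) (sym (Σ-+ (suc m) (λ l → choose m (toℕ l) * y (suc (toℕ l)))
                                         (λ l → choose m (suc (toℕ l)) * y (suc (toℕ l))))) ⟩
    1 * y 0 + Σᴺ (suc m) (λ l → choose m l * y (suc l) + choose m (suc l) * y (suc l))
  ≡⟨ cong (1 * y 0 +_) (Σ-cong (suc m) (λ l →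
       sym (*-distribʳ-+ (y (suc (toℕ l))) (choose m (toℕ l)) (choose m (suc (toℕ l)))))) ⟩
    1 * y 0 + Σᴺ (suc m) (λ l → choose (suc m) (suc l) * y (suc l))
  ∎
  where
  open ≡-Reasoning
  S₁ = Σᴺ (suc m) (λ l → choose m l * y (suc l))
  S₂ = Σᴺ m (λ l → choose m (suc l) * y (suc l))
  -- the extra term C(m, m+1)·y(m+1) vanishes
  S₂-extend : Σᴺ (suc m) (λ l → choose m (suc l) * y (suc l)) ≡ S₂
  S₂-extend = trans (Σᴺ-last m (λ l → choose m (suc l) * y (suc l)))
              (trans (cong (λ z → S₂ + z * y (suc m)) (choose-big m (suc m) (n<1+n m))) (+-identityʳ S₂))

module MatrixBinomial {n} (X : Mat n) where

  binomial : ∀ m r c → ((𝐈 ⊕ X) ^ᴹ m) r c ≡ Σᴺ (suc m) (λ l → choose m l * (X ^ᴹ l) r c)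
  binomial zero    r c = sym (trans (+-identityʳ _) (*-identityˡ _))
  binomial (suc m) r c = begin
      Σᶠ n (λ s → (δ r s + X r s) * P s c)
    ≡⟨ trans (Σ-cong n (λ s → *-distribʳ-+ (P s c) (δ r s) (X r s))) (Σ-+ n _ _) ⟩
      Σᶠ n (λ s → δ r s * P s c) + Σᶠ n (λ s → X r s * P s c)
    ≡⟨ cong₂ _+_ (trans (Σ-δˡ n r (λ s → P s c)) (binomial m r c))
                 (Σ-cong n (λ s → trans (cong (X r s *_) (binomial m s c)) (sym (Σ-*ˡ (suc m) (X r s) (λ l → choose m (toℕ l) * Y (toℕ l) s c))))) ⟩
      Σᴺ (suc m) (λ l → choose m l * Y l r c) + Σᶠ n (λ s → Σᴺ (suc m) (λ l → X r s * (choose m l * Y l s c)))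
    ≡⟨ cong (Σᴺ (suc m) (λ l → choose m l * Y l r c) +_)
            (Σ-swap n (suc m) (λ s l → X r s * (choose m (toℕ l) * Y (toℕ l) s c))) ⟩
      Σᴺ (suc m) (λ l → choose m l * Y l r c) + Σᴺ (suc m) (λ l → Σᶠ n (λ s → X r s * (choose m l * Y l s c)))
    ≡⟨ cong (Σᴺ (suc m) (λ l → choose m l * Y l r c) +_) (Σ-cong (suc m) (λ l → pull-out (toℕ l))) ⟩
      Σᴺ (suc m) (λ l → choose m l * Y l r c) + Σᴺ (suc m) (λ l → choose m l * Y (suc l) r c)
    ≡⟨ pascal m (λ l → Y l r c) ⟩
      Σᴺ (suc (suc m)) (λ l → choose (suc m) l * Y l r c)
    ∎
    where
    open ≡-Reasoning
    P = (𝐈 ⊕ X) ^ᴹ m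
    Y = X ^ᴹ_
    pull-out : ∀ l → Σᶠ n (λ s → X r s * (choose m l * Y l s c)) ≡ choose m l * Y (suc l) r c
    pull-out l = trans (Σ-cong n (λ s → x∙yz≈y∙xz (X r s) (choose m l) (Y l s c))) (Σ-*ˡ n (choose m l) _)

  higher : ℕ → Mat n
  higher m r c = Σᴺ m (λ l → choose m (suc l) * (X ^ᴹ suc l) r c)

  binomial′ : ∀ m r c → ((𝐈 ⊕ X) ^ᴹ m) r c ≡ δ r c + higher m r c
  binomial′ m r c = trans (binomial m r c) (cong (_+ higher m r c) (*-identityˡ (δ r c)))

  module _ (K : ℕ) (X-band : ∀ r c → toℕ c < toℕ r + K → X r c ≡ 0) where

    ^-band : ∀ l r c → toℕ c < toℕ r + l * K → (X ^ᴹ l) r c ≡ 0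
    ^-band zero    r c lt = δ-> (subst (toℕ c <_) (+-identityʳ (toℕ r)) lt)
    ^-band (suc l) r c lt = Σ-zero n term
      where
      term : ∀ s → X r s * (X ^ᴹ l) s c ≡ 0
      term s with toℕ s <? toℕ r + K
      ... | yes s<r+K = cong (_* (X ^ᴹ l) s c) (X-band r s s<r+K)
      ... | no s≮r+K  = trans (cong (X r s *_) (^-band l s c lt')) (*-zeroʳ (X r s))
        where
        lt' : toℕ c < toℕ s + l * K
        lt' = <-≤-trans lt (subst (_≤ toℕ s + l * K) (+-assoc (toℕ r) K (l * K)) (+-monoˡ-≤ (l * K) (≮⇒≥ s≮r+K)))

    higher-∣ : ∀ p (pp : Prime p) → 1 ≤ K → ∀ a T r c → toℕ c < toℕ r + p ^ T * K →
               p ^ (suc a ∸ T) ∣ higher (p ^ a) r c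
    higher-∣ p pp 1≤K a T r c lt = Σ-∣ (p ^ a) _ (λ l → term (toℕ l))
      where
      open PrimeFacts p pp
      term : ∀ l → p ^ (suc a ∸ T) ∣ choose (p ^ a) (suc l) * (X ^ᴹ suc l) r c
      term l with toℕ c <? toℕ r + suc l * K
      ... | yes c<r+lK = subst (p ^ (suc a ∸ T) ∣_)
                           (sym (trans (cong (choose (p ^ a) (suc l) *_) (^-band (suc l) r c c<r+lK)) (*-zeroʳ (choose (p ^ a) (suc l)))))
                           (_ ∣0)
      ... | no c≮r+lK = ∣m⇒∣m*n _ (choose-pow-∣ a T (suc l) (s≤s z≤n) l+1<p^T)
        where
        instance _ = >-nonZero 1≤K
        l+1<p^T : suc l < p ^ T
        l+1<p^T = *-cancelʳ-< K (suc l) (p ^ T)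
                    (+-cancelˡ-< (toℕ r) (suc l * K) (p ^ T * K) (≤-<-trans (≮⇒≥ c≮r+lK) lt))

module Elementary (N : ℕ) .{{_ : NonZero N}} (n : ℕ) where
  open MatN N
  open Banded N n

  El : Fin n → Fin n → Mat n
  El a b = transv 1 (E a b)

  E²≡0 : ∀ {a b : Fin n} → toℕ a < toℕ b → E a b · E a b ≋ 𝟎
  E²≡0 {a} {b} a<b = E·E-≢ {a = a} {b} {a} {b} (λ b≡a → <⇒≢ a<b (sym (cong toℕ b≡a)))

  transv-Bd1 : ∀ s {a b : Fin n} → toℕ a < toℕ b → Bd 1 (transv s (E a b))
  transv-Bd1 s {a} {b} a<b r c lt =
    ≡⇒≅ (trans (cong (δ r c +_) (trans (cong (s *_) E-zero) (*-zeroʳ s))) (+-identityʳ _))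
    where
    E-zero : δ a r * δ b c ≡ 0
    E-zero with a ≟ r
    ... | no _     = refl
    ... | yes refl = trans (+-identityʳ _)
                       (δ-> (≤-<-trans (≤-pred (subst (toℕ c <_) (+-comm (toℕ a) 1) lt)) a<b))

  El-unip : ∀ {a b} → toℕ a < toℕ b → Unipotent N n (El a b)
  El-unip a<b = Bd1⇒unip (transv-Bd1 1 a<b)

  -- The commutator relation [I + E_{a a₁}, I + E_{a₁ b}] = I + E_ab for a < a₁ < b.
  module _ {a a₁ b : Fin n} (a<a₁ : toℕ a < toℕ a₁) (a₁<b : toℕ a₁ < toℕ b) where
    private
      E₁ = E a a₁
      E₂ = E a₁ b
      E₃ = E a b
      g  = El a a₁
      h  = El a₁ b
      g⁻¹ = transv (N ∸ 1) E₁
      h⁻¹ = transv (N ∸ 1) E₂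
      ≢-of-< : ∀ {x y : Fin n} → toℕ x < toℕ y → y ≢ x
      ≢-of-< lt y≡x = <⇒≢ lt (sym (cong toℕ y≡x))
      E₂E₁≡0 : E₂ · E₁ ≋ 𝟎
      E₂E₁≡0 = E·E-≢ {a = a₁} {b} {a} {a₁} (≢-of-< (<-trans a<a₁ a₁<b))
      -- hg = I + D, and column a of D is zero
      D = 1 ⊛ E₂ ⊕ 1 ⊛ E₁ ⊕ (1 ⊛ E₂) · (1 ⊛ E₁)
      D-col-a : ∀ r → D r a ≡ 0
      D-col-a r = cong₂ _+_
        (cong₂ _+_ (cong (1 *_) (trans (cong (δ a₁ r *_) (δ-≢ (≢-of-< (<-trans a<a₁ a₁<b)))) (*-zeroʳ (δ a₁ r))))
                   (cong (1 *_) (trans (cong (δ a r *_) (δ-≢ (≢-of-< a<a₁))) (*-zeroʳ (δ a r)))))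
        (trans (⊛-· 1 1 E₂ E₁ r a) (cong (λ z → 1 * (1 * z)) (E₂E₁≡0 r a)))

    gh≋hg·El : g · h ≋ (h · g) · El a b
    gh≋hg·El r c = begin
        (g · h) r c
      ≡⟨ I+·I+ (1 ⊛ E₁) (1 ⊛ E₂) r c ⟩
        δ r c + (1 * E₁ r c + 1 * E₂ r c + ((1 ⊛ E₁) · (1 ⊛ E₂)) r c)
      ≡⟨ cong (λ z → δ r c + (1 * E₁ r c + 1 * E₂ r c + z))
              (trans (⊛-· 1 1 E₁ E₂ r c) (cong (λ z → 1 * (1 * z)) (E·E-≡ a a₁ b r c))) ⟩
        δ r c + (1 * E₁ r c + 1 * E₂ r c + 1 * (1 * E₃ r c))
      ≡⟨ rearrange (δ r c) (E₁ r c) (E₂ r c) (E₃ r c) ⟩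
        δ r c + ((1 * E₂ r c + 1 * E₁ r c + 1 * (1 * 0)) + 1 * E₃ r c + 1 * (0 * 0))
      ≡⟨ cong₂ (λ u v → δ r c + ((1 * E₂ r c + 1 * E₁ r c + u) + 1 * E₃ r c + v))
           (sym (trans (⊛-· 1 1 E₂ E₁ r c) (cong (λ z → 1 * (1 * z)) (E₂E₁≡0 r c))))
           (sym (trans (·-⊛ʳ 1 D E₃ r c) (cong (1 *_) (trans (·Eʳ a b D r c) (cong (_* δ b c) (D-col-a r)))))) ⟩
        δ r c + (D r c + 1 * E₃ r c + (D · (1 ⊛ E₃)) r c)
      ≡⟨ sym (I+·I+ D (1 ⊛ E₃) r c) ⟩
        ((𝐈 ⊕ D) · El a b) r c
      ≡⟨ sym (·-cong (I+·I+ (1 ⊛ E₂) (1 ⊛ E₁)) (≋-refl {A = El a b}) r c) ⟩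
        ((h · g) · El a b) r c
      ∎
      where
      open ≡-Reasoning
      open +-*-Solver
      rearrange : ∀ d x y z → d + (1 * x + 1 * y + 1 * (1 * z))
                             ≡ d + ((1 * y + 1 * x + 1 * (1 * 0)) + 1 * z + 1 * (0 * 0))
      rearrange = solve 4 (λ d x y z → d :+ (con 1 :* x :+ con 1 :* y :+ con 1 :* (con 1 :* z))
                           := d :+ ((con 1 :* y :+ con 1 :* x :+ con 1 :* (con 1 :* con 0)) :+ con 1 :* z
                                    :+ con 1 :* (con 0 :* con 0))) refl

    El-commutator : ∀ {B : Pred n} → B h → Comm N n (Unipotent N n) B (El a b)
    El-commutator Bh = g , h , g⁻¹ , h⁻¹ , El-unip a<a₁ , Bh
                  , transv-inv E₁ (E²≡0 a<a₁) , transv-inv E₂ (E²≡0 a₁<b) , El≈[g,h]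
      where
      El≈[g,h] : El a b ≈ (((g⁻¹ · h⁻¹) · g) · h)
      El≈[g,h] = ≈-sym (≈-trans (commutator-assoc g h g⁻¹ h⁻¹) (≈-trans (·-≈ (≈-refl {A = g⁻¹}) strip-h) strip-g))
        where
        -- h⁻¹(gh) = h⁻¹(h(g·El)) = g·El
        strip-h : h⁻¹ · (g · h) ≈ g · El a b
        strip-h = ≈-trans (·-≈ (≈-refl {A = h⁻¹}) (≋⇒≈ (≋-trans gh≋hg·El (·-assoc h g (El a b)))))
                          (·-cancel-inv {x = h} {h⁻¹} (g · El a b) (transv-inv′ E₂ (E²≡0 a₁<b)))
        strip-g : g⁻¹ · (g · El a b) ≈ El a b
        strip-g = ·-cancel-inv {x = g} {g⁻¹} (El a b) (transv-inv′ E₁ (E²≡0 a<a₁))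

  El-LCS : ∀ k {a b : Fin n} → toℕ a + suc k ≤ toℕ b → LCS N n (suc k) (El a b)
  El-LCS zero    {a} {b} le = El-unip (subst (_≤ toℕ b) (+-comm (toℕ a) 1) le)
  El-LCS (suc k) {a} {b} le = gen (El-commutator a<a₁ a₁<b (El-LCS k {a₁} {b} le'))
    where
    a+1<n : toℕ a + 1 < n
    a+1<n = <-trans (<-≤-trans (+-monoʳ-< (toℕ a) (s≤s (s≤s (z≤n {k})))) le) (toℕ<n b)
    a₁ : Fin n
    a₁ = fromℕ< a+1<n
    toℕ-a₁ : toℕ a₁ ≡ toℕ a + 1
    toℕ-a₁ = toℕ-fromℕ< a+1<n
    a<a₁ : toℕ a < toℕ a₁
    a<a₁ = subst (toℕ a <_) (sym toℕ-a₁) (m<m+n (toℕ a) (s≤s z≤n))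
    le' : toℕ a₁ + suc k ≤ toℕ b
    le' = subst (_≤ toℕ b) (trans (sym (+-assoc (toℕ a) 1 (suc k))) (cong (_+ suc k) (sym toℕ-a₁))) le
    a₁<b : toℕ a₁ < toℕ b
    a₁<b = <-≤-trans (m<m+n (toℕ a₁) (s≤s z≤n)) le'

ind : ℕ → ℕ → ℕ
ind y z with y ℕ.≟ z
... | yes _ = 1
... | no _  = 0

ind-yes : ∀ {y z} → y ≡ z → ind y z ≡ 1
ind-yes {y} {z} e with y ℕ.≟ z
... | yes _ = refl
... | no ne = ⊥-elim (ne e)

ind-no : ∀ {y z} → y ≢ z → ind y z ≡ 0
ind-no {y} {z} ne with y ℕ.≟ z
... | yes e = ⊥-elim (ne e)
... | no _  = refl

-- shift K t x y = 1 iff x < t and y = x + K: the sum of E_{x,x+K} over x < t.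
shift : ℕ → ℕ → ℕ → ℕ → ℕ
shift K t x y with x <? t
... | yes _ = ind y (x + K)
... | no _  = 0

shift-yes : ∀ {K t x y} → x < t → shift K t x y ≡ ind y (x + K)
shift-yes {K} {t} {x} {y} lt with x <? t
... | yes _ = refl
... | no ge = ⊥-elim (ge lt)

shift-no : ∀ {K t x y} → ¬ x < t → shift K t x y ≡ 0
shift-no {K} {t} {x} {y} nlt with x <? t
... | yes lt = ⊥-elim (nlt lt)
... | no _   = refl

shift-off : ∀ {K t x y} → y ≢ x + K → shift K t x y ≡ 0
shift-off {K} {t} {x} {y} ne with x <? t
... | yes _ = ind-no ne
... | no _  = refl

shift-suc : ∀ {K t x y} → x ≢ t → shift K (suc t) x y ≡ shift K t x y
shift-suc {K} {t} {x} {y} ne with x <? suc t | x <? t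
... | yes _  | yes _   = refl
... | yes lt | no nlt  = ⊥-elim (nlt (≤∧≢⇒< (≤-pred lt) ne))
... | no nlt | yes lt  = ⊥-elim (nlt (m<n⇒m<1+n lt))
... | no _   | no _    = refl

module Paths (N : ℕ) .{{_ : NonZero N}} (n k : ℕ) where
  open MatN N
  open Banded N n using (LCS-one; LCS-·; LCS-resp)
  open Elementary N n using (El; El-LCS)

  K : ℕ
  K = suc k

  S : ℕ → Mat n
  S t r c = shift K t (toℕ r) (toℕ c)

  -- P t = I + Σ_{x<t} E_{x,x+K} = (I + E_{t-1,t-1+K}) ⋯ (I + E_{0,K}).
  P : ℕ → Mat n
  P t = 𝐈 ⊕ S t

  S-band : ∀ t r c → toℕ c < toℕ r + K → S t r c ≡ 0
  S-band t r c lt = shift-off {K} {t} {toℕ r} {toℕ c} (<⇒≢ lt)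

  P-step : ∀ t (t<n : t < n) (t+K<n : t + K < n) → El (fromℕ< t<n) (fromℕ< t+K<n) · P t ≋ P (suc t)
  P-step t t<n t+K<n r c = trans (I+·I+ (1 ⊛ E a b) (S t) r c) (cong (δ r c +_) entry)
    where
    a = fromℕ< t<n
    b = fromℕ< t+K<n
    toℕ-a : toℕ a ≡ t
    toℕ-a = toℕ-fromℕ< t<n
    toℕ-b : toℕ b ≡ t + K
    toℕ-b = toℕ-fromℕ< t+K<n
    -- row b of S t is zero, so E_ab · S t = 0
    S-row-b : S t b c ≡ 0
    S-row-b = shift-no (λ lt → <⇒≱ lt (subst (t ≤_) (sym toℕ-b) (m≤m+n t K)))
    δ-b : δ b c ≡ ind (toℕ c) (t + K)
    δ-b with b ≟ c
    ... | yes refl = sym (ind-yes toℕ-b)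
    ... | no ne    = sym (ind-no (λ e → ne (toℕ-injective (trans toℕ-b (sym e)))))
    new-row : δ a r * δ b c + S t r c ≡ S (suc t) r c
    new-row with a ≟ r
    ... | yes refl = trans (cong₂ _+_ (*-identityˡ (δ b c)) (shift-no (λ lt → <⇒≱ lt (≤-reflexive (sym toℕ-a)))))
                     (trans (+-identityʳ _) (trans δ-b (trans (cong (λ z → ind (toℕ c) (z + K)) (sym toℕ-a))
                            (sym (shift-yes (subst (_< suc t) (sym toℕ-a) ≤-refl))))))
    ... | no ne    = sym (shift-suc (λ e → ne (toℕ-injective (trans toℕ-a (sym e)))))
    entry : 1 * E a b r c + S t r c + ((1 ⊛ E a b) · S t) r c ≡ S (suc t) r c
    entry = begin
        1 * E a b r c + S t r c + ((1 ⊛ E a b) · S t) r c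
      ≡⟨ cong (1 * E a b r c + S t r c +_)
              (trans (·-⊛ˡ 1 (E a b) (S t) r c) (cong (1 *_) (trans (E·ˡ a b (S t) r c) (cong (δ a r *_) S-row-b)))) ⟩
        1 * (δ a r * δ b c) + S t r c + 1 * (δ a r * 0)
      ≡⟨ cong (λ z → 1 * (δ a r * δ b c) + S t r c + 1 * z) (*-zeroʳ (δ a r)) ⟩
        1 * (δ a r * δ b c) + S t r c + 0
      ≡⟨ trans (+-identityʳ _) (cong (_+ S t r c) (*-identityˡ _)) ⟩
        δ a r * δ b c + S t r c
      ≡⟨ new-row ⟩
        S (suc t) r c
      ∎
      where open ≡-Reasoning

  P-LCS : ∀ t → t + K ≤ n → LCS N n K (P t)
  P-LCS zero    _  = LCS-resp k (≋⇒≈ (≋-sym (λ r c → +-identityʳ (δ r c)))) (LCS-one k)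
  P-LCS (suc t) le =
    LCS-resp k (≋⇒≈ (P-step t t<n le)) (LCS-· k (El-LCS k le') (P-LCS t (≤-trans (n≤1+n _) le)))
    where
    t<n : t < n
    t<n = ≤-<-trans (m≤m+n t K) le
    le' : toℕ (fromℕ< t<n) + K ≤ toℕ (fromℕ< le)
    le' = ≤-reflexive (trans (cong (_+ K) (toℕ-fromℕ< t<n)) (sym (toℕ-fromℕ< le)))

  module _ (t : ℕ) (t+K≤n : t + K ≤ n) where
    open MatrixBinomial (S t)

    S^q : ∀ q x (r : Fin n) → toℕ r ≡ x → x + q * K < t + K → ∀ c → (S t ^ᴹ q) r c ≡ ind (toℕ c) (x + q * K)
    S^q zero x r r≡x lt c with r ≟ c
    ... | yes refl = sym (ind-yes (trans r≡x (sym (+-identityʳ x))))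
    ... | no ne    = sym (ind-no (λ e → ne (toℕ-injective (trans r≡x (trans (sym (+-identityʳ x)) (sym e))))))
    S^q (suc q) x r r≡x lt c =
      trans (Σ-single n _ s₀ off)
      (trans (cong (_* (S t ^ᴹ q) s₀ c) on) (trans (*-identityˡ _)
      (trans (S^q q (x + K) s₀ toℕ-s₀ lt' c) (cong (ind (toℕ c)) (+-assoc x K (q * K))))))
      where
      lt' : x + K + q * K < t + K
      lt' = subst (_< t + K) (sym (+-assoc x K (q * K))) lt
      x+K<t+K : x + K < t + K
      x+K<t+K = ≤-<-trans (m≤m+n (x + K) (q * K)) lt'
      x+K<n : x + K < n
      x+K<n = <-≤-trans x+K<t+K t+K≤n
      s₀ = fromℕ< x+K<n
      toℕ-s₀ : toℕ s₀ ≡ x + K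
      toℕ-s₀ = toℕ-fromℕ< x+K<n
      on : S t r s₀ ≡ 1
      on = trans (cong (λ z → shift K t z (toℕ s₀)) r≡x)
                 (trans (shift-yes (+-cancelʳ-< K x t x+K<t+K)) (ind-yes toℕ-s₀))
      off : ∀ s → s ≢ s₀ → S t r s * (S t ^ᴹ q) s c ≡ 0
      off s ne = cong (_* (S t ^ᴹ q) s c) (trans (cong (λ z → shift K t z (toℕ s)) r≡x)
                   (shift-off {K} {t} {x} {toℕ s} (λ e → ne (toℕ-injective (trans e (sym toℕ-s₀))))))

    -- Row 0 of (P t)^m at column lK is exactly C(m, l) (for 1 ≤ l ≤ m, lK < t + K):
    -- only the term X^l of the binomial expansion reaches that column.
    P^m-entry : ∀ m l → 1 ≤ l → l ≤ m → l * K < t + K → (r₀ c : Fin n) → toℕ r₀ ≡ 0 → toℕ c ≡ l * K →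
                (P t ^ᴹ m) r₀ c ≡ choose m l
    P^m-entry m (suc l) _ l+1≤m lt r₀ c r₀≡0 c≡lK = trans (binomial′ m r₀ c) (cong₂ _+_ δ≡0 higher≡)
      where
      δ≡0 : δ r₀ c ≡ 0
      δ≡0 = δ-≢ (λ e → <⇒≢ (subst (0 <_) (sym c≡lK) (s≤s z≤n)) (trans (sym r₀≡0) (cong toℕ e)))
      higher≡ : higher m r₀ c ≡ choose m (suc l)
      higher≡ = trans (Σᴺ-single m _ l l+1≤m off)
                (trans (cong (choose m (suc l) *_) (trans (S^q (suc l) 0 r₀ r₀≡0 lt c) (ind-yes c≡lK))) (*-identityʳ _))
        where
        off : ∀ j → j ≢ l → choose m (suc j) * (S t ^ᴹ suc j) r₀ c ≡ 0
        off j j≢l with suc j ≤? suc l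
        ... | yes le = trans (cong (choose m (suc j) *_)
                         (trans (S^q (suc j) 0 r₀ r₀≡0 (≤-<-trans (*-monoˡ-≤ K le) lt) c)
                                (ind-no (λ e → j≢l (suc-injective (*-cancelʳ-≡ (suc j) (suc l) K (sym (trans (sym c≡lK) e))))))))
                         (*-zeroʳ (choose m (suc j)))
        ... | no nle = trans (cong (choose m (suc j) *_)
                         (^-band K (S-band t) (suc j) r₀ c
                           (subst (_< toℕ r₀ + suc j * K) (sym c≡lK)
                             (subst (suc l * K <_) (cong (_+ suc j * K) (sym r₀≡0)) (*-monoˡ-< K (≰⇒> nle))))))
                         (*-zeroʳ (choose m (suc j)))

%-scale : ∀ a b p q .{{_ : NonZero p}} .{{_ : NonZero (p * q)}} →
          a % p ≡ b % p → (a * q) % (p * q) ≡ (b * q) % (p * q)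
%-scale a b p q h = trans (sym (m%n*o≡m*o%[n*o] a p q)) (trans (cong (_* q) h) (m%n*o≡m*o%[n*o] b p q))

%-unscale : ∀ a b p q .{{_ : NonZero p}} .{{_ : NonZero q}} .{{_ : NonZero (p * q)}} →
            (a * q) % (p * q) ≡ (b * q) % (p * q) → a % p ≡ b % p
%-unscale a b p q h =
  *-cancelʳ-≡ (a % p) (b % p) q (trans (m%n*o≡m*o%[n*o] a p q) (trans h (sym (m%n*o≡m*o%[n*o] b p q))))

module InverseModP (p : ℕ) (pp : Prime p) where
  open PrimeFacts p pp
  open ModN p

  inverse : ∀ t → ¬ (p ∣ t) → ∃ λ u → u * t ≅ 1
  inverse t p∤t = from-Bézout (coprime-Bézout coprime)
    where
    t′ = t % p
    instance
      t′≢0 : NonZero t′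
      t′≢0 = ≢-nonZero (λ e → p∤t (m%n≡0⇒n∣m t p e))
    coprime : Coprime p t′
    coprime = prime⇒coprime pp (m%n<n t p)
    t≅t′ : t ≅ t′
    t≅t′ = sym (m%n%n≡m%n t p)
    open +-*-Solver
    from-Bézout : Bézout.Identity 1 p t′ → ∃ λ u → u * t ≅ 1
    from-Bézout (Bézout.-+ x y eq) =
      y , ≅-trans (≅-* (≅-refl {y}) t≅t′) (≅-trans (≡⇒≅ (sym eq)) (%-remove-+ʳ 1 {x * p} {p} (n∣m*n x)))
    from-Bézout (Bézout.+- x y eq) =
      y * (p ∸ 1) , ≅-trans (≅-* (≅-refl {y * (p ∸ 1)}) t≅t′) (≅-cancel+ {s = p ∸ 1} both)
      where
      a = p ∸ 1
      both : y * a * t′ + a ≅ 1 + a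
      both = ≅-trans (≡⇒≅ (trans (solve 3 (λ Y A T → Y :* A :* T :+ A := A :* (con 1 :+ Y :* T)) refl y a t′)
                                 (cong (a *_) eq)))
             (≅-trans (∣⇒≅0 (∣-trans (n∣m*n x) (n∣m*n a)))
                      (≅-sym (∣⇒≅0 (subst (p ∣_) (sym (m+[n∸m]≡n (<⇒≤ 1<p))) ∣-refl))))

module Corner (p : ℕ) (pp : Prime p) (i j : ℕ) (1≤i : 1 ≤ i) where
  open PrimeFacts p pp public
  instance
    N≢0 : NonZero (p ^ suc j)
    N≢0 = m^n≢0 p (suc j)
    q≢0 : NonZero (p ^ j)
    q≢0 = m^n≢0 p j

  N n q : ℕ
  N = p ^ suc j
  n = suc i
  q = p ^ j

  open MatN N public
  open Banded N n public
  open Elementary N n using (transv-Bd1) public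

  last : Fin n
  last = fromℕ i

  toℕ-last : toℕ last ≡ i
  toℕ-last = toℕ-fromℕ i

  last≢0 : last ≢ zero
  last≢0 e = <⇒≢ 1≤i (sym (trans (sym toℕ-last) (cong toℕ e)))

  Ec : Mat n
  Ec = E zero last

  Ec²≡0 : Ec · Ec ≋ 𝟎
  Ec²≡0 = E·E-≢ {a = zero} {last} {zero} {last} last≢0

  Cm : ℕ → Mat n
  Cm t = transv (t * q) Ec

  Cm-corner : ∀ t → Cm t zero last ≡ t * q
  Cm-corner t = trans (cong₂ (λ u v → u + t * q * v) (δ-≢ (λ e → last≢0 (sym e))) (cong (_* δ last last) (δ-refl {n} zero)))
                      (trans (cong (λ v → t * q * (1 * v)) (δ-refl last)) (*-identityʳ (t * q)))

  Cm-off : ∀ t r c → (r ≡ zero → c ≢ last) → Cm t r c ≡ δ r c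
  Cm-off t r c h = trans (cong (δ r c +_) (trans (cong (t * q *_) Ec-zero) (*-zeroʳ (t * q)))) (+-identityʳ _)
    where
    Ec-zero : δ zero r * δ last c ≡ 0
    Ec-zero with zero ≟ r
    ... | no _  = refl
    ... | yes e = trans (+-identityʳ _) (δ-≢ (λ e' → h (sym e) (sym e')))

  q∣Cm : ∀ t c → c ≢ zero → q ∣ Cm t zero c
  q∣Cm t c ne = subst (q ∣_) (sym (cong (_+ t * q * (δ {n} zero zero * δ last c)) (δ-≢ {n} {zero} {c} (λ e → ne (sym e)))))
                      (∣m⇒∣m*n _ (n∣m*n t))

  isCorner : Mat n → Set
  isCorner x = ∃ λ t → x ≈ Cm t

  -- isCorner is CornerSub from Defs, phrased through Cm.
  private
    Cm-last : ∀ t c → c ≡ last → Cm t zero c ≡ δ zero c + t * q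
    Cm-last t c refl = cong (δ zero last +_) (trans (cong (λ u → t * q * (u * δ last last)) (δ-refl {n} zero))
                         (trans (cong (λ v → t * q * (1 * v)) (δ-refl last)) (*-identityʳ (t * q))))

  toCorner : ∀ {x} → isCorner x → CornerSub N i q x
  toCorner {x} (t , x≈Cm) = t , conv
    where
    conv : _
    conv zero c with x≈Cm zero c
    ... | e with c ≟ fromℕ i
    ... | yes eq = trans e (cong (_% N) (Cm-last t c eq))
    ... | no ne  = trans e (cong (_% N) (Cm-off t zero c (λ _ → ne)))
    conv (suc r) c = trans (x≈Cm (suc r) c) (cong (_% N) (Cm-off t (suc r) c (λ ())))

  fromCorner : ∀ {x} → CornerSub N i q x → isCorner x
  fromCorner {x} (t , ex) = t , conv
    where
    conv : x ≈ Cm t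
    conv zero c with ex zero c
    ... | e with c ≟ fromℕ i
    ... | yes eq = trans e (cong (_% N) (sym (Cm-last t c eq)))
    ... | no ne  = trans e (cong (_% N) (sym (Cm-off t zero c (λ _ → ne))))
    conv (suc r) c = trans (ex (suc r) c) (cong (_% N) (sym (Cm-off t (suc r) c (λ ()))))

  Cm-· : ∀ a b → Cm a · Cm b ≋ Cm (a + b)
  Cm-· a b = ≋-trans (transv-+ (a * q) (b * q) Ec Ec²≡0)
                     (λ r c → cong (λ z → δ r c + z * Ec r c) (sym (*-distribʳ-+ q a b)))

  -- Right inverses of corner matrices are corner matrices: Cm a · Cm (a(p-1)) = I,
  -- and Cm a can be cancelled.
  corner-inv : ∀ {x y} → isCorner x → x · y ≈ 𝐈 → isCorner y
  corner-inv {x} {y} (a , x≈Cm) xy = b , Agree-all (cancel bx agree)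
    where
    b = a * (p ∸ 1)
    a+b≡aN : a * q + b * q ≡ a * N
    a+b≡aN = begin
        a * q + a * (p ∸ 1) * q   ≡⟨ sym (*-distribʳ-+ q a (a * (p ∸ 1))) ⟩
        (a + a * (p ∸ 1)) * q     ≡⟨ cong (_* q) (trans (cong (_+ a * (p ∸ 1)) (sym (*-identityʳ a)))
                                                        (sym (*-distribˡ-+ a 1 (p ∸ 1)))) ⟩
        a * (1 + (p ∸ 1)) * q     ≡⟨ cong (λ z → a * z * q) (m+[n∸m]≡n (<⇒≤ 1<p)) ⟩
        a * p * q                 ≡⟨ *-assoc a p q ⟩
        a * N                     ∎
      where open ≡-Reasoning
    CaCb : Cm a · Cm b ≈ 𝐈
    CaCb = ≈-trans (≋⇒≈ (transv-+ (a * q) (b * q) Ec Ec²≡0)) (transv-N (a * q + b * q) Ec (subst (N ∣_) (sym a+b≡aN) (n∣m*n a)))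
    bx : Bd 1 x
    bx = Agree-trans (≈⇒Agree x≈Cm) (transv-Bd1 (a * q) (subst (0 <_) (sym toℕ-last) 1≤i))
    agree : Agree n (x · y) (x · Cm b)
    agree = ≈⇒Agree (≈-trans xy (≈-sym (≈-trans (·-≈ x≈Cm (≈-refl {A = Cm b})) CaCb)))

  Gen-corner : ∀ {S : Pred n} → (∀ x → S x → isCorner x) → ∀ {x} → Gen N n S x → isCorner x
  Gen-corner hs = Gen-ind isCorner hs (0 , ≋⇒≈ (transv-0 Ec))
    (λ (a , ea) (b , eb) → a + b , ≈-trans (·-≈ ea eb) (≋⇒≈ (Cm-· a b)))
    corner-inv
    (λ e (t , ex) → t , ≈-trans (≈-sym e) ex)

  Gen-trivial : ∀ {S : Pred n} → (∀ x → S x → x ≈ 𝐈) → ∀ {x} → Gen N n S x → x ≈ 𝐈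
  Gen-trivial hs = Gen-ind (_≈ 𝐈) hs ≈-refl
    (λ a b → ≈-trans (·-≈ a b) (≋⇒≈ (·-identityˡ 𝐈)))
    (λ {x} {y} a xy → ≈-trans (≋⇒≈ (≋-sym (·-identityˡ y))) (≈-trans (·-≈ (≈-sym a) (≈-refl {A = y})) xy))
    (λ e h → ≈-trans (≈-sym e) h)

module Powers (p : ℕ) (pp : Prime p) (i j : ℕ) (1≤i : 1 ≤ i) (k : ℕ) (K≤i : suc k ≤ i) (j' : ℕ) where
  open Corner p pp i j 1≤i

  K m : ℕ
  K = suc k
  m = p ^ j'

  IsPower : Pred n
  IsPower x = ∃ λ y → LCS N n K y × x ≈ (y ^ᴹ m)

  PL : Pred n
  PL = Gen N n IsPower

  c≤i : ∀ (c : Fin n) → toℕ c ≤ i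
  c≤i c = ≤-pred (toℕ<n c)

  above : Mat n → Mat n
  above y r c with toℕ c <? toℕ r + K
  ... | yes _ = 0
  ... | no _  = y r c

  above-band : ∀ y r c → toℕ c < toℕ r + K → above y r c ≡ 0
  above-band y r c lt with toℕ c <? toℕ r + K
  ... | yes _   = refl
  ... | no nlt  = ⊥-elim (nlt lt)

  I+above : ∀ {y} → Bd K y → y ≈ 𝐈 ⊕ above y
  I+above {y} b r c with toℕ c <? toℕ r + K
  ... | yes lt  = ≅-trans (b r c lt) (≡⇒≅ (sym (+-identityʳ _)))
  ... | no nlt  = ≡⇒≅ (sym (cong (_+ y r c) (δ-< (<-≤-trans (m<m+n (toℕ r) (s≤s z≤n)) (≮⇒≥ nlt)))))

  H : Mat n → Mat n
  H y = MatrixBinomial.higher (above y) m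

  power-form : ∀ {y} → LCS N n K y → ∀ r c → (y ^ᴹ m) r c ≅ δ r c + H y r c
  power-form {y} y∈LCS r c = ≅-trans (^-≈ m (I+above (LCS⊆Bd k y∈LCS)) r c)
                                     (≡⇒≅ (MatrixBinomial.binomial′ (above y) m r c))

  H-∣ : ∀ y T r c → toℕ c < toℕ r + p ^ T * K → p ^ (suc j' ∸ T) ∣ H y r c
  H-∣ y T r c lt = MatrixBinomial.higher-∣ (above y) K (above-band y) p pp (s≤s z≤n) j' T r c lt

  power-trivial : ∀ T → i < p ^ T * K → suc j ≤ suc j' ∸ T → ∀ {x} → PL x → x ≈ 𝐈
  power-trivial T i<p^TK le = Gen-trivial trivial
    where
    trivial : ∀ x → IsPower x → x ≈ 𝐈
    trivial x (y , y∈LCS , x≈y^m) r c =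
      ≅-trans (x≈y^m r c) (≅-trans (power-form y∈LCS r c)
                          (≅-trans (≅-+ (≅-refl {δ r c}) H≅0) (≡⇒≅ (+-identityʳ _))))
      where
      H≅0 : H y r c ≅ 0
      H≅0 = ∣⇒≅0 (∣-trans (^-monoʳ-∣ le)
                  (H-∣ y T r c (<-≤-trans (≤-<-trans (c≤i c) i<p^TK) (m≤n+m _ (toℕ r)))))

  -- If i ≤ p^e K and j' = j + e, then (𝕌^(K))^m lies in the corner subgroup:
  -- every entry of H is divisible by N, except the corner which is divisible by p^j.
  power-corner : ∀ e → i ≤ p ^ e * K → j' ≡ j + e → ∀ {x} → PL x → isCorner x
  power-corner e i≤p^eK j'≡j+e = Gen-corner corner
    where
    j'+1∸[e+1] : suc j' ∸ suc e ≡ j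
    j'+1∸[e+1] = trans (cong (_∸ e) j'≡j+e) (m+n∸n≡m j e)
    j'+1∸e : suc j' ∸ e ≡ suc j
    j'+1∸e = trans (cong (λ z → suc z ∸ e) j'≡j+e) (m+n∸n≡m (suc j) e)
    -- the corner (0, i) lies in the band of width p^(e+1) K
    corner-in-band : toℕ last < toℕ {n} zero + p ^ suc e * K
    corner-in-band = subst (toℕ last <_) (trans (*-comm _ p) (sym (*-assoc p (p ^ e) K)))
      (subst (_< p ^ e * K * p) (sym toℕ-last)
        (≤-<-trans i≤p^eK (m<m*n (p ^ e * K) p {{>-nonZero (≤-trans 1≤i i≤p^eK)}} 1<p)))
    -- every other entry lies in the band of width p^e K
    off-corner-in-band : ∀ r c → (r ≡ zero → c ≢ last) → toℕ c < toℕ r + p ^ e * K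
    off-corner-in-band zero    c h = <-≤-trans (≤∧≢⇒< (c≤i c) (λ e' → h refl (toℕ-injective (trans e' (sym toℕ-last))))) i≤p^eK
    off-corner-in-band (suc r) c h = s≤s (≤-trans (≤-trans (c≤i c) i≤p^eK) (m≤n+m _ (toℕ r)))

    corner : ∀ x → IsPower x → isCorner x
    corner x (y , y∈LCS , x≈y^m) = t , λ r c → ≅-trans (x≈y^m r c) (≅-trans (power-form y∈LCS r c) (entry r c))
      where
      q∣H : q ∣ H y zero last
      q∣H = subst (λ z → p ^ z ∣ H y zero last) j'+1∸[e+1] (H-∣ y (suc e) zero last corner-in-band)
      t : ℕ
      t = quotient q∣H
      off : ∀ r c → (r ≡ zero → c ≢ last) → δ r c + H y r c ≅ Cm t r c
      off r c h = ≅-trans (≅-+ (≅-refl {δ r c}) (∣⇒≅0 (subst (λ z → p ^ z ∣ H y r c) j'+1∸e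
                                                   (H-∣ y e r c (off-corner-in-band r c h)))))
                          (≡⇒≅ (trans (+-identityʳ _) (sym (Cm-off t r c h))))
      entry : ∀ r c → δ r c + H y r c ≅ Cm t r c
      entry r c with r ≟ zero | c ≟ last
      ... | yes refl | yes refl = ≡⇒≅ (trans (cong (δ zero last +_) (_∣_.equality q∣H))
                                             (trans (cong (_+ t * q) (δ-≢ (λ e' → last≢0 (sym e'))))
                                                    (sym (Cm-corner t))))
      ... | yes refl | no c≢last = off zero c (λ _ → c≢last)
      ... | no r≢0   | _         = off r c (λ r≡0 → ⊥-elim (r≢0 r≡0))

  -- For p^b K ≤ i and b ≤ j', the element (P t)^m (t = (p^b - 1)K + 1) of
  -- (𝕌^(K))^m has entry C(m, p^b) at (0, p^b K).
  record Witness (b : ℕ) : Set where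
    field
      x     : Mat n
      x∈PL  : PL x
      col   : Fin n
      col≡  : toℕ col ≡ p ^ b * K
      entry : x zero col ≡ choose m (p ^ b)

  witness : ∀ b → p ^ b * K ≤ i → b ≤ j' → Witness b
  witness b le b≤j' = record
    { x = P t ^ᴹ m ; x∈PL = gen (P t , P-LCS t t+K≤n , ≈-refl) ; col = c ; col≡ = toℕ-c
    ; entry = P^m-entry t t+K≤n m l (m^n>0 p b) (^-monoʳ-≤ p b≤j') lK<t+K zero c refl toℕ-c }
    where
    open Paths N n k using (P; P-LCS; P^m-entry)
    l = p ^ b
    t = (l ∸ 1) * K + 1
    t+K≡ : t + K ≡ suc (l * K)
    t+K≡ = shift-eq l (m^n>0 p b)
      where
      shift-eq : ∀ L → 1 ≤ L → (L ∸ 1) * K + 1 + K ≡ suc (L * K)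
      shift-eq (suc L) _ = trans (+-assoc (L * K) 1 K) (trans (+-suc (L * K) K) (cong suc (+-comm (L * K) K)))
    t+K≤n : t + K ≤ n
    t+K≤n = subst (_≤ n) (sym t+K≡) (s≤s le)
    lK<t+K : l * K < t + K
    lK<t+K = subst (l * K <_) (sym t+K≡) ≤-refl
    c = fromℕ< {l * K} (s≤s le)
    toℕ-c : toℕ c ≡ l * K
    toℕ-c = toℕ-fromℕ< (s≤s le)

  col≢0 : ∀ b (c : Fin n) → toℕ c ≡ p ^ b * K → c ≢ zero
  col≢0 b c toℕ-c e = <⇒≢ (≤-trans (m^n>0 p b) (m≤m*n (p ^ b) K)) (sym (trans (sym toℕ-c) (cong toℕ e)))

  witness-≇0 : ∀ b → b ≤ j' → j' ∸ b ≤ j → (w : Witness b) → ¬ (Witness.x w zero (Witness.col w) ≅ 0)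
  witness-≇0 b b≤j' le w x≅0 =
    choose-pow-pow-∤ j' b j b≤j' le (≅0⇒∣ (subst (_≅ 0) (Witness.entry w) x≅0))

  trivial-row0 : ∀ {x} → x ≈ 𝐈 → ∀ (c : Fin n) → c ≢ zero → x zero c ≅ 0
  trivial-row0 x≈I c ne = ≅-trans (x≈I zero c) (≡⇒≅ (δ-≢ (λ e → ne (sym e))))

  corner-row0 : ∀ {x} → isCorner x → ∀ (c : Fin n) → c ≢ zero → c ≢ last → x zero c ≅ 0
  corner-row0 (t , x≈Cm) c c≢0 c≢last =
    ≅-trans (x≈Cm zero c) (≡⇒≅ (trans (Cm-off t zero c (λ _ → c≢last)) (δ-≢ (λ e → c≢0 (sym e)))))

  -- The corner subgroup lies in (𝕌^(K))^m once some element x₀ of it equals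
  -- I + t₀ p^j E with t₀ a unit mod p: the powers of x₀ give every I + t p^j E.
  corner⊆PL : ∀ {x₀ t₀} → PL x₀ → x₀ ≈ Cm t₀ → ¬ (p ∣ t₀) → ∀ {x} → isCorner x → PL x
  corner⊆PL {x₀} {t₀} x₀∈PL x₀≈Cm p∤t₀ {x} (t , x≈Cm) = resp chain (Gen-^ e x₀∈PL)
    where
    open InverseModP p pp using (inverse)
    u = proj₁ (inverse t₀ p∤t₀)
    e = t * u
    et₀≡t : (e * t₀) % p ≡ t % p
    et₀≡t = ModN.≅-trans p (ModN.≡⇒≅ p (*-assoc t u t₀))
              (ModN.≅-trans p (ModN.≅-* p (ModN.≅-refl p {t}) (proj₂ (inverse t₀ p∤t₀))) (ModN.≡⇒≅ p (*-identityʳ t)))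
    e·t₀q≅tq : e * (t₀ * q) ≅ t * q
    e·t₀q≅tq = ≅-trans (≡⇒≅ (sym (*-assoc e t₀ q))) (%-scale (e * t₀) t p q et₀≡t)
    chain : x₀ ^ᴹ e ≈ x
    chain = ≈-trans (^-≈ e x₀≈Cm) (≈-trans (≋⇒≈ (transv-^ (t₀ * q) Ec Ec²≡0 e))
            (≈-trans (λ r c → ≅-+ (≅-refl {δ r c}) (≅-* e·t₀q≅tq (≅-refl {Ec r c}))) (≈-sym x≈Cm)))

  part-a : ∀ e → IsFloorLog p i K e → ((∀ x → PL x ⇔ (x ≈ 𝐈)) ⇔ (j' ≥ j + 1 + e))
  part-a e (p^eK≤i , i<p^[e+1]K) = mk⇔ necessary sufficient
    where
    sufficient : j' ≥ j + 1 + e → ∀ x → PL x ⇔ (x ≈ 𝐈)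
    sufficient j'≥ x = mk⇔ (power-trivial (suc e) i<p^[e+1]K le) (λ x≈I → resp (≈-sym x≈I) one)
      where
      le : suc j ≤ j' ∸ e
      le = subst (_≤ j' ∸ e) (trans (m+n∸n≡m (j + 1) e) (+-comm j 1)) (∸-monoˡ-≤ e j'≥)

    -- if j' ≤ j + e, the witness for b = min(j', e) is a nontrivial element
    necessary : (∀ x → PL x ⇔ (x ≈ 𝐈)) → j' ≥ j + 1 + e
    necessary all-trivial with j + 1 + e ≤? j'
    ... | yes j'≥ = j'≥
    ... | no j'≱  = ⊥-elim (nontrivial (small-b (≤-pred (subst (suc j' ≤_) (cong (_+ e) (+-comm j 1)) (≰⇒> j'≱)))))
      where
      small-b : j' ≤ j + e → Σ ℕ λ b → p ^ b * K ≤ i × b ≤ j' × j' ∸ b ≤ j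
      small-b j'≤j+e with j' ≤? e
      ... | yes j'≤e = j' , ≤-trans (*-monoˡ-≤ K (^-monoʳ-≤ p j'≤e)) p^eK≤i , ≤-refl
                          , subst (_≤ j) (sym (n∸n≡0 j')) z≤n
      ... | no j'≰e  = e , p^eK≤i , <⇒≤ (≰⇒> j'≰e) , subst (j' ∸ e ≤_) (m+n∸n≡m j e) (∸-monoˡ-≤ e j'≤j+e)
      nontrivial : (Σ ℕ λ b → p ^ b * K ≤ i × b ≤ j' × j' ∸ b ≤ j) → ⊥
      nontrivial (b , le , b≤j' , small) = witness-≇0 b b≤j' small w
        (trivial-row0 (Equivalence.to (all-trivial x) x∈PL) col (col≢0 b col col≡))
        where
        w = witness b le b≤j'
        open Witness w

  -- If j' < j: the witness for b = 0 has entry m = p^j' at (0, K), which is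
  -- not a multiple of p^j, so (𝕌^(K))^m is not in the corner subgroup.
  small-exponent : j' < j → ¬ (∀ x → PL x → isCorner x)
  small-exponent j'<j ⊆corner = <⇒≱ (^-monoʳ-< p 1<p j'<j) (∣⇒≤ {{m^n≢0 p j'}} q∣m)
    where
    w = witness 0 (subst (_≤ i) (sym (+-identityʳ K)) K≤i) z≤n
    open Witness w
    q∣m : q ∣ m
    q∣m with ⊆corner x x∈PL
    ... | t , x≈Cm = subst (q ∣_) (trans entry (choose-1 m))
                      (≅-resp-∣ (divides p refl) (≅-sym (x≈Cm zero col)) (q∣Cm t col (col≢0 0 col col≡)))

  -- If p^e K < i and j' ∸ e ≤ j: the witness entry at (0, p^e K) is neither
  -- zero nor in the corner column.
  narrow-band : ∀ e → p ^ e * K < i → e ≤ j' → j' ∸ e ≤ j → ¬ (∀ x → PL x → isCorner x)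
  narrow-band e p^eK<i e≤j' small ⊆corner =
    witness-≇0 e e≤j' small w (corner-row0 (⊆corner x x∈PL) col (col≢0 e col col≡) col≢last)
    where
    w = witness e (<⇒≤ p^eK<i) e≤j'
    open Witness w
    col≢last : col ≢ last
    col≢last e' = <⇒≢ p^eK<i (trans (sym col≡) (trans (cong toℕ e') toℕ-last))

  -- (c) (𝕌^(K))^m ≤ I + p^j ℤ E  ⇔  j' ≥ j + log_p(i/K), i.e. j' = j + e with i ≤ p^e K
  part-c : (∀ x → PL x → CornerSub N i q x) ⇔ (∃ λ e → i ≤ p ^ e * K × j' ≡ j + e)
  part-c = mk⇔ necessary sufficient
    where
    sufficient : (∃ λ e → i ≤ p ^ e * K × j' ≡ j + e) → ∀ x → PL x → CornerSub N i q x
    sufficient (e , i≤p^eK , j'≡j+e) x x∈PL = toCorner (power-corner e i≤p^eK j'≡j+e x∈PL)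

    necessary : (∀ x → PL x → CornerSub N i q x) → ∃ λ e → i ≤ p ^ e * K × j' ≡ j + e
    necessary ⊆C = choose-e (λ x x∈PL → fromCorner (⊆C x x∈PL))
      where
      choose-e : (∀ x → PL x → isCorner x) → ∃ λ e → i ≤ p ^ e * K × j' ≡ j + e
      choose-e ⊆corner with j ≤? j' | i ≤? p ^ (j' ∸ j) * K
      ... | no j≰j'  | _      = ⊥-elim (small-exponent (≰⇒> j≰j') ⊆corner)
      ... | yes j≤j' | yes ok = j' ∸ j , ok , sym (m+[n∸m]≡n j≤j')
      ... | yes j≤j' | no nok =
        ⊥-elim (narrow-band (j' ∸ j) (≰⇒> nok) (m∸n≤m j' j) (≤-reflexive (m∸[m∸n]≡n j≤j')) ⊆corner)

  -- For p^e K = i and j' = j + e, (𝕌^(K))^m contains the corner subgroup: the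
  -- witness for b = e is I + u p^j E with u = C(p^j' - 1, p^e - 1) prime to p.
  corner-generated : ∀ e → p ^ e * K ≡ i → j' ≡ j + e → ∀ {x} → isCorner x → PL x
  corner-generated e p^eK≡i j'≡j+e = corner⊆PL W.x∈PL x₀≈Cm p∤t₀
    where
    e≤j' : e ≤ j'
    e≤j' = subst (e ≤_) (sym j'≡j+e) (m≤n+m e j)
    module W = Witness (witness e (≤-reflexive p^eK≡i) e≤j')
    x₀-corner : isCorner W.x
    x₀-corner = power-corner e (≤-reflexive (sym p^eK≡i)) j'≡j+e W.x∈PL
    t₀ = proj₁ x₀-corner
    x₀≈Cm : W.x ≈ Cm t₀
    x₀≈Cm = proj₂ x₀-corner
    u = unitPart j' e
    col≡last : W.col ≡ last
    col≡last = toℕ-injective (trans W.col≡ (trans p^eK≡i (sym toℕ-last)))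
    corner-entry : W.x zero last ≡ u * q
    corner-entry = trans (subst (λ z → W.x zero z ≡ choose m (p ^ e)) col≡last W.entry)
                   (trans (choose-pow-pow j' e e≤j')
                   (trans (cong (λ z → p ^ z * u) (trans (cong (_∸ e) j'≡j+e) (m+n∸n≡m j e))) (*-comm q u)))
    u≅t₀ : u % p ≡ t₀ % p
    u≅t₀ = %-unscale u t₀ p q (trans (cong (_% N) (sym corner-entry))
                                     (trans (x₀≈Cm zero last) (cong (_% N) (Cm-corner t₀))))
    p∤t₀ : ¬ (p ∣ t₀)
    p∤t₀ d = unitPart-unit j' e e≤j' (m%n≡0⇒n∣m u p (trans u≅t₀ (n∣m⇒m%n≡0 t₀ p d)))

  part-b : (∀ x → PL x ⇔ CornerSub N i q x) ⇔ (∃ λ e → p ^ e * K ≡ i × j' ≡ j + e)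
  part-b = mk⇔ necessary sufficient
    where
    sufficient : (∃ λ e → p ^ e * K ≡ i × j' ≡ j + e) → ∀ x → PL x ⇔ CornerSub N i q x
    sufficient (e , p^eK≡i , j'≡j+e) x =
      mk⇔ (λ x∈PL → toCorner (power-corner e (≤-reflexive (sym p^eK≡i)) j'≡j+e x∈PL))
          (λ x∈C → corner-generated e p^eK≡i j'≡j+e (fromCorner x∈C))

    -- by (c), j' = j + e with i ≤ p^e K; if i < p^e K then (𝕌^(K))^m = {I} by
    -- the upper bound, but I + p^j E is not trivial
    necessary : (∀ x → PL x ⇔ CornerSub N i q x) → ∃ λ e → p ^ e * K ≡ i × j' ≡ j + e
    necessary h with Equivalence.to part-c (λ x → Equivalence.to (h x))
    ... | e , i≤p^eK , j'≡j+e with p ^ e * K ℕ.≟ i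
    ...   | yes p^eK≡i = e , p^eK≡i , j'≡j+e
    ...   | no  p^eK≢i = ⊥-elim (<⇒≱ (^-monoʳ-< p 1<p (n<1+n j)) (∣⇒≤ N∣q))
      where
      Cm1-trivial : Cm 1 ≈ 𝐈
      Cm1-trivial = power-trivial e (≤∧≢⇒< i≤p^eK (λ eq → p^eK≢i (sym eq)))
        (≤-reflexive (sym (trans (cong (λ z → suc z ∸ e) j'≡j+e) (m+n∸n≡m (suc j) e))))
        (Equivalence.from (h (Cm 1)) (toCorner (1 , ≈-refl)))
      N∣q : N ∣ q
      N∣q = ≅0⇒∣ (subst (_≅ 0) (trans (Cm-corner 1) (*-identityˡ q))
                   (trivial-row0 Cm1-trivial last last≢0))

-- Proposition 6.2.  Since i' ≥ 1 we write i' = k + 1; the subsets in the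
-- statement unfold to those of Powers, whose three parts are the claims.
proposition6p2 : (p : ℕ) → (pp : Prime p) → (i j i' j' : ℕ) → 1 ≤ i → 1 ≤ i' → i' ≤ i →
    let open Setting p pp i j in
    ((e : ℕ) → IsFloorLog p i i' e → ((PowLCS i' j' ≐ₛ TrivialSub) ⇔ (j' ≥ j + 1 + e)))
    × ((PowLCS i' j' ≐ₛ CornerSubgroup) ⇔ (∃ λ e → (p ^ e) * i' ≡ i × j' ≡ j + e))
    × ((PowLCS i' j' ⊆ₛ CornerSubgroup) ⇔ (∃ λ e → i ≤ (p ^ e) * i' × j' ≡ j + e))
proposition6p2 p pp i j zero     j' 1≤i ()  i'≤i
proposition6p2 p pp i j (suc k)  j' 1≤i 1≤i' i'≤i = part-a , part-b , part-c
  where open Powers p pp i j 1≤i k i'≤i j'
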